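{- Let $k\ge 2$ be an integer. For $n\ge 0$ define the (renormalized Charlier) polynomial \[C_n(a,r)=\sum_{m=0}^{n}\binom{n}{m}(a)_m\,r^{n-m},\qquad (u)_m=u(u+1)\cdots(u+m-1),\ (u)_0=1.\] Let $a_1,\dots,a_k,r_1,\dots,r_k$ be indeterminates and let $x_{ij}$ ($1\le i<j\le k$) be indeterminates, with the convention $x_{ji}=x_{ij}$. Then, as formal power series in the $x_{ij}$, \[ \sum_{(n_{ij})} \frac{\prod_{1\le i<j\le k} x_{ij}^{n_{ij}}}{\prod_{1\le i<j\le k} n_{ij}!}\, C_{n_1}(a_1,r_1)\cdots C_{n_k}(a_k,r_k) =\prod_{1\le i<j\le k} e^{r_ir_jx_{ij}} \sum_{(n_{ij})}\ \prod_{1\le i\le k}\frac{(a_i)_{n_i}}{\bigl(1-\sum_{j\ne i} r_jx_{ij}\bigr)^{n_i+a_i}}\ \frac{\prod_{1\le i<j\le k} x_{ij}^{n_{ij}}}{\prod_{1\le i<j\le k} n_{ij}!}, \] where each sum runs over all $k\times k$ symmetric matrices $(n_{ij})$ with non-negative integer entries and zero diagonal entries, and $n_i=\sum_{j=1}^k n_{ij}$ for $1\le i\le k$.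
   Context: $(1-w)^{ -c}$ for an indeterminate $c$ and a power series $w$ without constant term denotes the formal binomial series $\sum_{m\ge0}(c)_m w^m/m!$. -}

module Defs where

open import Level using (Level)
open import Function using (_∘_)
open import Data.Bool using (Bool; true; false; if_then_else_; _∧_)
open import Data.Nat as ℕ using (ℕ; zero; suc; _∸_; _!; _≡ᵇ_; _<ᵇ_)
open import Data.Nat.Combinatorics using (_C_)
open import Data.Fin as Fin using (Fin; toℕ)
open import Data.List using (List; []; _∷_; concatMap; map; upTo; foldr)
open import Data.Vec.Functional as VF using ()
open import Relation.Nullary.Decidable using (does)
open import Algebra.Bundles using (CommutativeRing)

piList : ∀ {a} {A : Set a} (n : ℕ) → (Fin n → List A) → List (Fin n → A)
piList zero    L = (λ ()) ∷ []
piList (suc n) L =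
  concatMap (λ x → map (λ f → x VF.∷ f) (piList n (L ∘ Fin.suc))) (L Fin.zero)

andFin : (n : ℕ) → (Fin n → Bool) → Bool
andFin zero    f = true
andFin (suc n) f = f Fin.zero ∧ andFin n (f ∘ Fin.suc)

sumℕFin : (n : ℕ) → (Fin n → ℕ) → ℕ
sumℕFin zero    f = 0
sumℕFin (suc n) f = f Fin.zero ℕ.+ sumℕFin n (f ∘ Fin.suc)

-- Exponent matrices (monomials in the k² variables x_pq)
Mono : ℕ → Set
Mono k = Fin k → Fin k → ℕ

below : {k : ℕ} → Mono k → List (Mono k)
below {k} e = piList k (λ i → piList k (λ j → upTo (suc (e i j))))

_∸ᴹ_ : {k : ℕ} → Mono k → Mono k → Mono k
(e ∸ᴹ d) i j = e i j ∸ d i j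

isUpper : {k : ℕ} → Mono k → Bool
isUpper {k} d = andFin k (λ i → andFin k (λ j →
  if toℕ i <ᵇ toℕ j then true else (d i j ≡ᵇ 0)))

isZeroM : {k : ℕ} → Mono k → Bool
isZeroM {k} e = andFin k (λ i → andFin k (λ j → e i j ≡ᵇ 0))

isUnitM : {k : ℕ} → Fin k → Fin k → Mono k → Bool
isUnitM {k} p q e = andFin k (λ i → andFin k (λ j →
  e i j ≡ᵇ (if does (i Fin.≟ p) ∧ does (j Fin.≟ q) then 1 else 0)))

deg : {k : ℕ} → Mono k → ℕ
deg {k} e = sumℕFin k (λ i → sumℕFin k (λ j → e i j))

-- Formal power series over a commutative ring R in the variables
-- x_pq (p q : Fin k); those with p < q are the x_ij of the paper.

module Series {c ℓ : Level} (R : CommutativeRing c ℓ) (k : ℕ) where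
  open CommutativeRing R

  fromℕR : ℕ → Carrier
  fromℕR zero    = 0#
  fromℕR (suc n) = 1# + fromℕR n

  powR : Carrier → ℕ → Carrier
  powR x zero    = 1#
  powR x (suc n) = powR x n * x

  rising : Carrier → ℕ → Carrier
  rising u zero    = 1#
  rising u (suc m) = rising u m * (u + fromℕR m)

  sumL : List Carrier → Carrier
  sumL = foldr _+_ 0#

  sumFinR : (n : ℕ) → (Fin n → Carrier) → Carrier
  sumFinR zero    f = 0#
  sumFinR (suc n) f = f Fin.zero + sumFinR n (f ∘ Fin.suc)

  prodFinR : (n : ℕ) → (Fin n → Carrier) → Carrier
  prodFinR zero    f = 1#
  prodFinR (suc n) f = f Fin.zero * prodFinR n (f ∘ Fin.suc)

  prodPairsR : (Fin k → Fin k → Carrier) → Carrier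
  prodPairsR f = prodFinR k (λ i → prodFinR k (λ j →
    if toℕ i <ᵇ toℕ j then f i j else 1#))

  charlier : ℕ → Carrier → Carrier → Carrier
  charlier n a r =
    sumL (map (λ m → fromℕR (n C m) * rising a m * powR r (n ∸ m)) (upTo (suc n)))

  -- power series = coefficient functions
  PS : Set c
  PS = Mono k → Carrier

  constPS : Carrier → PS
  constPS x e = if isZeroM e then x else 0#

  zeroPS onePS : PS
  zeroPS = constPS 0#
  onePS  = constPS 1#

  var : Fin k → Fin k → PS
  var p q e = if isUnitM p q e then 1# else 0#

  -- x_ij with the convention x_ji = x_ij
  symVar : Fin k → Fin k → PS
  symVar i j = if toℕ i <ᵇ toℕ j then var i j else var j i

  _⊕_ : PS → PS → PS
  (F ⊕ G) e = F e + G e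

  scale : Carrier → PS → PS
  scale x F e = x * F e

  _⊗_ : PS → PS → PS
  (F ⊗ G) e = sumL (map (λ d → F d * G (e ∸ᴹ d)) (below e))

  powPS : PS → ℕ → PS
  powPS F zero    = onePS
  powPS F (suc m) = powPS F m ⊗ F

  sumFinPS : (n : ℕ) → (Fin n → PS) → PS
  sumFinPS zero    f = zeroPS
  sumFinPS (suc n) f = f Fin.zero ⊕ sumFinPS n (f ∘ Fin.suc)

  prodFinPS : (n : ℕ) → (Fin n → PS) → PS
  prodFinPS zero    f = onePS
  prodFinPS (suc n) f = f Fin.zero ⊗ prodFinPS n (f ∘ Fin.suc)

  prodPairsPS : (Fin k → Fin k → PS) → PS
  prodPairsPS f = prodFinPS k (λ i → prodFinPS k (λ j →
    if toℕ i <ᵇ toℕ j then f i j else onePS))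

  -- Σ over strictly upper triangular d of x^d · F d
  -- (a locally finite sum, so its coefficients are finite sums)
  sumX : (Mono k → PS) → PS
  sumX F e = sumL (map (λ d → if isUpper d then F d (e ∸ᴹ d) else 0#) (below e))

  module WithInverses (inv : ℕ → Carrier) where

    -- exp(w) = Σ_m w^m / m!   (w without constant term)
    expPS : PS → PS
    expPS w e = sumL (map (λ m → inv (m !) * powPS w m e) (upTo (suc (deg e))))

    -- (1-w)^{-c} = Σ_m (c)_m w^m / m!   (w without constant term)
    binomPS : Carrier → PS → PS
    binomPS c w e =
      sumL (map (λ m → rising c m * inv (m !) * powPS w m e) (upTo (suc (deg e))))

    invMatFact : Mono k → Carrier
    invMatFact d = prodPairsR (λ i j → inv (d i j !))

    -- n_i = Σ_j n_ij, for the symmetric matrix n_ij = d_ij + d_ji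
    rowSum : Mono k → Fin k → ℕ
    rowSum d i = sumℕFin k (λ j → d i j ℕ.+ d j i)

    module _ (a r : Fin k → Carrier) where

      lhs : PS
      lhs = sumX (λ d → constPS
        (invMatFact d * prodFinR k (λ i → charlier (rowSum d i) (a i) (r i))))

      rhs : PS
      rhs = prodPairsPS (λ i j → expPS (scale (r i * r j) (var i j)))
        ⊗ sumX (λ d → constPS (invMatFact d) ⊗ prodFinPS k (λ i →
            constPS (rising (a i) (rowSum d i))
            ⊗ binomPS (fromℕR (rowSum d i) + a i)
                (sumFinPS k (λ j →
                   if does (i Fin.≟ j) then zeroPS else scale (r j) (symVar i j)))))

module Submission where

open import Level using (Level; _⊔_)
open import Function using (_∘_; id)
open import Function.Bundles using (Equivalence)
open import Data.Bool using (Bool; true; false; T; if_then_else_; _∧_)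
open import Data.Bool.Properties using (T-≡)
open import Data.Empty using (⊥-elim)
open import Data.Nat as ℕ using (ℕ; zero; suc; _≤_; _<_; z≤n; s≤s; _∸_; _!; _≡ᵇ_; _<ᵇ_; NonZero)
import Data.Nat.Properties as NP
open import Data.Nat.Properties using (_!≢0)
open import Data.Nat.Combinatorics using (_C_; k>n⇒nCk≡0; nCk+nC[k+1]≡[n+1]C[k+1])
open import Data.Fin as Fin using (Fin; toℕ)
open import Data.Fin.Properties using (suc-injective; toℕ-injective; _≟_)
open import Data.List using (List; []; _∷_; _++_; applyUpTo; map; upTo; foldr; concatMap)
open import Data.List.Properties using (upTo-∷ʳ)
open import Data.Vec.Functional as VF using (updateAt)
open import Data.Vec.Functional.Properties using (updateAt-updates; updateAt-minimal; updateAt-id; updateAt-commutes)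
open import Data.Product using (_,_; _×_; proj₁; proj₂; Σ)
open import Data.Sum using (_⊎_; inj₁; inj₂)
open import Relation.Binary.PropositionalEquality as P using (_≡_; _≢_)
open import Relation.Nullary using (¬_; yes; no; does)
open import Relation.Nullary.Decidable using (dec-true; dec-false)
open import Algebra.Bundles using (CommutativeRing)
open import Defs

-- Both sides are families F(a) of power series indexed by the parameters a.
-- Writing S_i for the shift a_i ↦ a_i + 1, we show that both solve the system
--   F(a) has constant term 1,   ∂F(a)/∂x_pq = (r_p + a_p S_p)(r_q + a_q S_q) F(a) for p < q,
--   ∂F(a)/∂x_pq = 0 otherwise,
-- whose solution is unique by induction on the degree (this is where the
-- inverses of positive integers are used).  For the left side the equation
-- is the recurrence C_{n+1}(a,r) = r C_n(a,r) + a C_n(a+1,r) applied to the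
-- row sums n_p, n_q; for the right side it follows from the Leibniz rule.

piList-cong : ∀ {A : Set} (n : ℕ) {L L' : Fin n → List A} → (∀ i → L i ≡ L' i) → piList n L ≡ piList n L'
piList-cong zero    h = P.refl
piList-cong (suc n) {L} {L'} h
  rewrite h Fin.zero | piList-cong n {L ∘ Fin.suc} {L' ∘ Fin.suc} (h ∘ Fin.suc) = P.refl

T-true : ∀ {b} → b ≡ true → T b
T-true = Equivalence.from T-≡

false-if-¬T : ∀ {b} → ¬ T b → b ≡ false
false-if-¬T {false} _  = P.refl
false-if-¬T {true}  ¬t = ⊥-elim (¬t _)

true≢false : true ≢ false
true≢false ()

andFin-true : ∀ n {f : Fin n → Bool} → andFin n f ≡ true → ∀ i → f i ≡ true
andFin-true (suc n) {f} h Fin.zero with f Fin.zero | h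
... | true | _ = P.refl
andFin-true (suc n) {f} h (Fin.suc i) with f Fin.zero | h
... | true | h' = andFin-true n h' i

andFin-intro : ∀ n {f : Fin n → Bool} → (∀ i → f i ≡ true) → andFin n f ≡ true
andFin-intro zero    h = P.refl
andFin-intro (suc n) h rewrite h Fin.zero = andFin-intro n (h ∘ Fin.suc)

andFin-cong : ∀ n {f g : Fin n → Bool} → (∀ i → f i ≡ g i) → andFin n f ≡ andFin n g
andFin-cong zero    h = P.refl
andFin-cong (suc n) {f} {g} h
  rewrite h Fin.zero | andFin-cong n {f ∘ Fin.suc} {g ∘ Fin.suc} (h ∘ Fin.suc) = P.refl

≡ᵇ-sound : ∀ {m n} → (m ≡ᵇ n) ≡ true → m ≡ n
≡ᵇ-sound {m} {n} h = NP.≡ᵇ⇒≡ m n (T-true h)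

≡ᵇ-complete : ∀ {m n} → m ≡ n → (m ≡ᵇ n) ≡ true
≡ᵇ-complete {m} {n} h = Equivalence.to T-≡ (NP.≡⇒≡ᵇ m n h)

bool-ext : ∀ {b b' : Bool} → (b ≡ true → b' ≡ true) → (b' ≡ true → b ≡ true) → b ≡ b'
bool-ext {true}  {true}  f g = P.refl
bool-ext {true}  {false} f g = P.sym (f P.refl)
bool-ext {false} {true}  f g = g P.refl
bool-ext {false} {false} f g = P.refl

lt : ∀ {n} → Fin n → Fin n → Bool
lt i j = toℕ i <ᵇ toℕ j

lt-sound : ∀ {n} {i j : Fin n} → lt i j ≡ true → toℕ i < toℕ j
lt-sound {i = i} {j} h = NP.<ᵇ⇒< (toℕ i) (toℕ j) (T-true h)

lt⇒≢ : ∀ {n} {i j : Fin n} → lt i j ≡ true → i ≢ j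
lt⇒≢ {i = i} h P.refl = NP.<-irrefl P.refl (lt-sound {i = i} {j = i} h)

lt-asym : ∀ {n} {i j : Fin n} → lt i j ≡ true → lt j i ≡ false
lt-asym {i = i} {j} h = false-if-¬T (λ t → NP.<-asym (lt-sound {i = i} {j} h) (lt-sound {i = j} {i} (Equivalence.to T-≡ t)))

lt-tri : ∀ {n} {i j : Fin n} → lt i j ≡ false → lt j i ≡ false → i ≡ j
lt-tri {i = i} {j} h h' = toℕ-injective (NP.≤-antisym (ge h') (ge h))
  where
  ge : ∀ {x y : Fin _} → lt x y ≡ false → toℕ y ≤ toℕ x
  ge {x} {y} f = NP.≮⇒≥ (λ x<y → true≢false (P.trans (P.sym (Equivalence.to T-≡ (NP.<⇒<ᵇ x<y))) f))

sumℕFin-cong : ∀ n {f g : Fin n → ℕ} → (∀ i → f i ≡ g i) → sumℕFin n f ≡ sumℕFin n g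
sumℕFin-cong zero    h = P.refl
sumℕFin-cong (suc n) {f} {g} h
  rewrite h Fin.zero | sumℕFin-cong n {f ∘ Fin.suc} {g ∘ Fin.suc} (h ∘ Fin.suc) = P.refl

sumℕFin-bump : ∀ n (f g : Fin n → ℕ) x → f x ≡ suc (g x) → (∀ j → j ≢ x → f j ≡ g j) →
  sumℕFin n f ≡ suc (sumℕFin n g)
sumℕFin-bump (suc n) f g Fin.zero hx ho
  rewrite hx | sumℕFin-cong n {f ∘ Fin.suc} {g ∘ Fin.suc} (λ j → ho (Fin.suc j) (λ ())) = P.refl
sumℕFin-bump (suc n) f g (Fin.suc x) hx ho
  rewrite ho Fin.zero (λ ())
        | sumℕFin-bump n (f ∘ Fin.suc) (g ∘ Fin.suc) x hx (λ j ne → ho (Fin.suc j) (ne ∘ suc-injective))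
  = NP.+-suc _ _

sumℕFin-zero : ∀ n (f : Fin n → ℕ) → (∀ i → f i ≡ 0) → sumℕFin n f ≡ 0
sumℕFin-zero zero    f h = P.refl
sumℕFin-zero (suc n) f h rewrite h Fin.zero = sumℕFin-zero n (f ∘ Fin.suc) (h ∘ Fin.suc)

sumℕFin-zero⁻¹ : ∀ n (f : Fin n → ℕ) → sumℕFin n f ≡ 0 → ∀ i → f i ≡ 0
sumℕFin-zero⁻¹ (suc n) f h Fin.zero    = NP.m+n≡0⇒m≡0 (f Fin.zero) h
sumℕFin-zero⁻¹ (suc n) f h (Fin.suc i) = sumℕFin-zero⁻¹ n (f ∘ Fin.suc) (NP.m+n≡0⇒n≡0 (f Fin.zero) h) i

sumℕFin-pos : ∀ n (f : Fin n → ℕ) m → sumℕFin n f ≡ suc m → Σ (Fin n) λ i → Σ ℕ λ m' → f i ≡ suc m'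
sumℕFin-pos (suc n) f m h with f Fin.zero in e
... | suc m' = Fin.zero , m' , e
... | zero with sumℕFin-pos n (f ∘ Fin.suc) m h
...   | i , m' , e' = Fin.suc i , m' , e'

module Exponents (k : ℕ) where

  infix 4 _≗ᴹ_
  _≗ᴹ_ : Mono k → Mono k → Set
  d ≗ᴹ d' = ∀ i j → d i j ≡ d' i j

  -- incr e p q is e · x_pq, decr e p q is e / x_pq (when e_pq > 0).
  incr decr : Mono k → Fin k → Fin k → Mono k
  incr e p q = updateAt e p (λ row → updateAt row q suc)
  decr e p q = updateAt e p (λ row → updateAt row q ℕ.pred)

  incr-same : ∀ e p q → incr e p q p q ≡ suc (e p q)
  incr-same e p q rewrite updateAt-updates p {λ row → updateAt row q suc} e = updateAt-updates q (e p)

  incr-other : ∀ e p q i j → ¬ (i ≡ p × j ≡ q) → incr e p q i j ≡ e i j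
  incr-other e p q i j ne with i ≟ p
  ... | yes P.refl rewrite updateAt-updates p {λ row → updateAt row q suc} e =
          updateAt-minimal j q (e p) (λ jq → ne (P.refl , jq))
  ... | no ip = P.cong (λ row → row j) (updateAt-minimal i p e ip)

  data Position (p q i j : Fin k) : Set where
    here : i ≡ p → j ≡ q → Position p q i j
    away : ¬ (i ≡ p × j ≡ q) → Position p q i j

  position : ∀ p q i j → Position p q i j
  position p q i j with i ≟ p | j ≟ q
  ... | yes ip | yes jq = here ip jq
  ... | yes _  | no jq  = away (jq ∘ proj₂)
  ... | no ip  | _      = away (ip ∘ proj₁)

  incr-resp : ∀ {e e'} p q → e ≗ᴹ e' → incr e p q ≗ᴹ incr e' p q
  incr-resp {e} {e'} p q h i j with position p q i j
  ... | here P.refl P.refl rewrite incr-same e p q | incr-same e' p q = P.cong suc (h p q)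
  ... | away ne rewrite incr-other e p q i j ne | incr-other e' p q i j ne = h i j

  incr-∸-incr : ∀ e d p q → (incr e p q ∸ᴹ incr d p q) ≗ᴹ (e ∸ᴹ d)
  incr-∸-incr e d p q i j with position p q i j
  ... | here P.refl P.refl rewrite incr-same e p q | incr-same d p q = P.refl
  ... | away ne rewrite incr-other e p q i j ne | incr-other d p q i j ne = P.refl

  incr-∸ : ∀ e d p q → d p q ≤ e p q → (incr e p q ∸ᴹ d) ≗ᴹ incr (e ∸ᴹ d) p q
  incr-∸ e d p q le i j with position p q i j
  ... | here P.refl P.refl rewrite incr-same e p q | incr-same (e ∸ᴹ d) p q = NP.+-∸-assoc 1 le
  ... | away ne rewrite incr-other e p q i j ne | incr-other (e ∸ᴹ d) p q i j ne = P.refl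

  incr-decr : ∀ e p q m → e p q ≡ suc m → incr (decr e p q) p q ≗ᴹ e
  incr-decr e p q m h i j with position p q i j
  ... | here P.refl P.refl
      rewrite incr-same (decr e p q) p q
            | updateAt-updates p {λ row → updateAt row q ℕ.pred} e
            | updateAt-updates q {ℕ.pred} (e p) | h = P.refl
  ... | away ne rewrite incr-other (decr e p q) p q i j ne with i ≟ p
  ...   | yes P.refl rewrite updateAt-updates p {λ row → updateAt row q ℕ.pred} e =
            updateAt-minimal j q (e p) (λ jq → ne (P.refl , jq))
  ...   | no ip = P.cong (λ row → row j) (updateAt-minimal i p e ip)

  isZeroM-sound : ∀ e → isZeroM e ≡ true → ∀ i j → e i j ≡ 0
  isZeroM-sound e h i j = ≡ᵇ-sound (andFin-true k (andFin-true k h i) j)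

  isZeroM-intro : ∀ e → (∀ i j → e i j ≡ 0) → isZeroM e ≡ true
  isZeroM-intro e h = andFin-intro k (λ i → andFin-intro k (λ j → ≡ᵇ-complete (h i j)))

  isZeroM-cong : ∀ {e e'} → e ≗ᴹ e' → isZeroM e ≡ isZeroM e'
  isZeroM-cong h = andFin-cong k (λ i → andFin-cong k (λ j → P.cong (_≡ᵇ 0) (h i j)))

  isZeroM-incr : ∀ e p q → isZeroM (incr e p q) ≡ false
  isZeroM-incr e p q with isZeroM (incr e p q) in eq
  ... | false = P.refl
  ... | true = ⊥-elim (NP.0≢1+n (P.trans (P.sym (isZeroM-sound (incr e p q) eq p q)) (incr-same e p q)))

  isUnitM-cong : ∀ a b {e e'} → e ≗ᴹ e' → isUnitM a b e ≡ isUnitM a b e'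
  isUnitM-cong a b h = andFin-cong k (λ i → andFin-cong k (λ j → P.cong (_≡ᵇ _) (h i j)))

  both≟ : (i a j b : Fin k) → Bool
  both≟ i a j b = does (i ≟ a) ∧ does (j ≟ b)

  both≟-here : ∀ a b → both≟ a a b b ≡ true
  both≟-here a b rewrite dec-true (a ≟ a) P.refl | dec-true (b ≟ b) P.refl = P.refl

  both≟-away : ∀ i a j b → ¬ (i ≡ a × j ≡ b) → both≟ i a j b ≡ false
  both≟-away i a j b ne with i ≟ a | j ≟ b
  ... | yes P.refl | yes P.refl = ⊥-elim (ne (P.refl , P.refl))
  ... | yes _ | no _ = P.refl
  ... | no _  | _    = P.refl

  isUnitM-entry : ∀ a b e → isUnitM a b e ≡ true → ∀ i j → e i j ≡ (if both≟ i a j b then 1 else 0)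
  isUnitM-entry a b e h i j = ≡ᵇ-sound (andFin-true k (andFin-true k h i) j)

  isUnitM-intro : ∀ a b e → e a b ≡ 1 → (∀ i j → ¬ (i ≡ a × j ≡ b) → e i j ≡ 0) → isUnitM a b e ≡ true
  isUnitM-intro a b e h1 h0 = andFin-intro k (λ i → andFin-intro k (λ j → ≡ᵇ-complete (entry i j)))
    where
    entry : ∀ i j → e i j ≡ (if both≟ i a j b then 1 else 0)
    entry i j with position a b i j
    ... | here P.refl P.refl rewrite both≟-here a b = h1
    ... | away ne rewrite both≟-away i a j b ne = h0 i j ne

  isUpper-cong : ∀ {e e'} → e ≗ᴹ e' → isUpper e ≡ isUpper e'
  isUpper-cong h = andFin-cong k (λ i → andFin-cong k (λ j →
    P.cong (λ z → if lt i j then true else (z ≡ᵇ 0)) (h i j)))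

  isUpper-sound : ∀ d → isUpper d ≡ true → ∀ i j → lt i j ≡ false → d i j ≡ 0
  isUpper-sound d h i j l with andFin-true k (andFin-true k h i) j
  ... | e rewrite l = ≡ᵇ-sound e

  isUpper-intro : ∀ d → (∀ i j → lt i j ≡ false → d i j ≡ 0) → isUpper d ≡ true
  isUpper-intro d h = andFin-intro k (λ i → andFin-intro k (λ j → entry i j))
    where
    entry : ∀ i j → (if lt i j then true else (d i j ≡ᵇ 0)) ≡ true
    entry i j with lt i j in l
    ... | true  = P.refl
    ... | false = ≡ᵇ-complete (h i j l)

  isUpper-incr-above : ∀ d p q → lt p q ≡ true → isUpper (incr d p q) ≡ isUpper d
  isUpper-incr-above d p q l = bool-ext
    (λ h → isUpper-intro d (λ i j lij → P.trans (P.sym (incr-other d p q i j (off i j lij))) (isUpper-sound (incr d p q) h i j lij)))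
    (λ h → isUpper-intro _ (λ i j lij → P.trans (incr-other d p q i j (off i j lij)) (isUpper-sound d h i j lij)))
    where
    off : ∀ i j → lt i j ≡ false → ¬ (i ≡ p × j ≡ q)
    off i j lij (P.refl , P.refl) = true≢false (P.trans (P.sym l) lij)

  isUpper-incr-other : ∀ d p q → lt p q ≡ false → isUpper (incr d p q) ≡ false
  isUpper-incr-other d p q l with isUpper (incr d p q) in e
  ... | false = P.refl
  ... | true = ⊥-elim (NP.0≢1+n (P.trans (P.sym (isUpper-sound (incr d p q) e p q l)) (incr-same d p q)))

  deg-cong : ∀ {e e'} → e ≗ᴹ e' → deg e ≡ deg e'
  deg-cong h = sumℕFin-cong k (λ i → sumℕFin-cong k (h i))

  deg-incr : ∀ e p q → deg (incr e p q) ≡ suc (deg e)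
  deg-incr e p q = sumℕFin-bump k _ _ p
    (sumℕFin-bump k _ _ q (incr-same e p q) (λ j jq → incr-other e p q p j (jq ∘ proj₂)))
    (λ i ip → sumℕFin-cong k (λ j → incr-other e p q i j (ip ∘ proj₁)))

  zeroM : Mono k
  zeroM i j = 0

  deg-zero : ∀ e → deg e ≡ 0 → e ≗ᴹ zeroM
  deg-zero e h i j = sumℕFin-zero⁻¹ k _ (sumℕFin-zero⁻¹ k _ h i) j

  deg-suc : ∀ e N → deg e ≡ suc N → Σ (Fin k) λ p → Σ (Fin k) λ q → Σ ℕ λ m → e p q ≡ suc m
  deg-suc e N h with sumℕFin-pos k _ N h
  ... | p , m₁ , e₁ with sumℕFin-pos k _ m₁ e₁
  ...   | q , m , e₂ = p , q , m , e₂

  rowTotal : Mono k → Fin k → ℕ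
  rowTotal d i = sumℕFin k (λ j → d i j ℕ.+ d j i)

  rowTotal-cong : ∀ {d d'} → d ≗ᴹ d' → ∀ i → rowTotal d i ≡ rowTotal d' i
  rowTotal-cong h i = sumℕFin-cong k (λ j → P.cong₂ ℕ._+_ (h i j) (h j i))

  rowTotal-zero : ∀ i → rowTotal zeroM i ≡ 0
  rowTotal-zero i = sumℕFin-zero k _ (λ j → P.refl)

  module _ (d : Mono k) (p q : Fin k) (p≢q : p ≢ q) where

    rowTotal-incr-p : rowTotal (incr d p q) p ≡ suc (rowTotal d p)
    rowTotal-incr-p = sumℕFin-bump k _ _ q
      (P.cong₂ ℕ._+_ (incr-same d p q) (incr-other d p q q p (p≢q ∘ P.sym ∘ proj₁)))
      (λ j jq → P.cong₂ ℕ._+_ (incr-other d p q p j (jq ∘ proj₂)) (incr-other d p q j p (p≢q ∘ proj₂)))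

    rowTotal-incr-q : rowTotal (incr d p q) q ≡ suc (rowTotal d q)
    rowTotal-incr-q = sumℕFin-bump k _ _ p
      (P.trans (P.cong₂ ℕ._+_ (incr-other d p q q p (p≢q ∘ P.sym ∘ proj₁)) (incr-same d p q)) (NP.+-suc _ _))
      (λ j jp → P.cong₂ ℕ._+_ (incr-other d p q q j (p≢q ∘ P.sym ∘ proj₁)) (incr-other d p q j q (jp ∘ proj₁)))

    rowTotal-incr-other : ∀ i → i ≢ p → i ≢ q → rowTotal (incr d p q) i ≡ rowTotal d i
    rowTotal-incr-other i ip iq = sumℕFin-cong k (λ j →
      P.cong₂ ℕ._+_ (incr-other d p q i j (ip ∘ proj₁)) (incr-other d p q j i (iq ∘ proj₂)))

    rowTotal-incr : ∀ i → rowTotal (incr d p q) i ≡ updateAt (updateAt (rowTotal d) p suc) q suc i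
    rowTotal-incr i with i ≟ q
    ... | yes P.refl rewrite updateAt-updates i {suc} (updateAt (rowTotal d) p suc)
                           | updateAt-minimal i p {suc} (rowTotal d) (p≢q ∘ P.sym) = rowTotal-incr-q
    ... | no iq with i ≟ p
    ...   | yes P.refl rewrite updateAt-minimal i q {suc} (updateAt (rowTotal d) p suc) iq
                             | updateAt-updates i {suc} (rowTotal d) = rowTotal-incr-p
    ...   | no ip rewrite updateAt-minimal i q {suc} (updateAt (rowTotal d) p suc) iq
                        | updateAt-minimal i p {suc} (rowTotal d) ip = rowTotal-incr-other i ip iq

  deg-zeroM : deg zeroM ≡ 0
  deg-zeroM = sumℕFin-zero k _ (λ i → sumℕFin-zero k _ (λ j → P.refl))

module Development {c ℓ : Level} (R : CommutativeRing c ℓ) (k : ℕ) where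
  open CommutativeRing R hiding (zero)
  open Series R k
  open Exponents k
  open import Relation.Binary.Reasoning.Setoid setoid
  import Algebra.Solver.Ring.NaturalCoefficients.Default commutativeSemiring as Sol

  Σ_ : {A : Set} → List A → (A → Carrier) → Carrier
  Σ_ L χ = foldr _+_ 0# (map χ L)

  Σ-cong : {A : Set} (L : List A) {χ ψ : A → Carrier} → (∀ y → χ y ≈ ψ y) → Σ_ L χ ≈ Σ_ L ψ
  Σ-cong []      h = refl
  Σ-cong (x ∷ L) h = +-cong (h x) (Σ-cong L h)

  Σ-++ : {A : Set} (L M : List A) (χ : A → Carrier) → Σ_ (L ++ M) χ ≈ Σ_ L χ + Σ_ M χ
  Σ-++ []      M χ = sym (+-identityˡ _)
  Σ-++ (x ∷ L) M χ = trans (+-cong refl (Σ-++ L M χ)) (sym (+-assoc _ _ _))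

  Σ-map : {A B : Set} (L : List A) (f : A → B) (χ : B → Carrier) → Σ_ (map f L) χ ≡ Σ_ L (χ ∘ f)
  Σ-map []      f χ = P.refl
  Σ-map (x ∷ L) f χ = P.cong (χ (f x) +_) (Σ-map L f χ)

  Σ-concatMap : {A B : Set} (L : List A) (g : A → List B) (χ : B → Carrier) →
    Σ_ (concatMap g L) χ ≈ Σ_ L (λ x → Σ_ (g x) χ)
  Σ-concatMap []      g χ = refl
  Σ-concatMap (x ∷ L) g χ = trans (Σ-++ (g x) (concatMap g L) χ) (+-cong refl (Σ-concatMap L g χ))

  Σ-+ : {A : Set} (L : List A) (χ ψ : A → Carrier) → Σ_ L (λ y → χ y + ψ y) ≈ Σ_ L χ + Σ_ L ψ
  Σ-+ []      χ ψ = sym (+-identityˡ _)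
  Σ-+ (x ∷ L) χ ψ = begin
    (χ x + ψ x) + Σ_ L (λ y → χ y + ψ y) ≈⟨ +-cong refl (Σ-+ L χ ψ) ⟩
    (χ x + ψ x) + (Σ_ L χ + Σ_ L ψ)      ≈⟨ +-assoc _ _ _ ⟩
    χ x + (ψ x + (Σ_ L χ + Σ_ L ψ))      ≈⟨ +-cong refl (sym (+-assoc _ _ _)) ⟩
    χ x + ((ψ x + Σ_ L χ) + Σ_ L ψ)      ≈⟨ +-cong refl (+-cong (+-comm _ _) refl) ⟩
    χ x + ((Σ_ L χ + ψ x) + Σ_ L ψ)      ≈⟨ +-cong refl (+-assoc _ _ _) ⟩
    χ x + (Σ_ L χ + (ψ x + Σ_ L ψ))      ≈⟨ sym (+-assoc _ _ _) ⟩
    (χ x + Σ_ L χ) + (ψ x + Σ_ L ψ)      ∎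

  Σ-*ˡ : {A : Set} (L : List A) (a : Carrier) (χ : A → Carrier) → Σ_ L (λ y → a * χ y) ≈ a * Σ_ L χ
  Σ-*ˡ []      a χ = sym (zeroʳ a)
  Σ-*ˡ (x ∷ L) a χ = trans (+-cong refl (Σ-*ˡ L a χ)) (sym (distribˡ _ _ _))

  Σ-zero : {A : Set} (L : List A) (χ : A → Carrier) → (∀ y → χ y ≈ 0#) → Σ_ L χ ≈ 0#
  Σ-zero []      χ h = refl
  Σ-zero (x ∷ L) χ h = trans (+-cong (h x) (Σ-zero L χ h)) (+-identityˡ _)

  -- SeesOnly P L: a sum over L only depends on the summands at elements
  -- satisfying P (an invariant describing the elements of L).
  SeesOnly : {A : Set} → (A → Set) → List A → Set (c ⊔ ℓ)
  SeesOnly P L = ∀ (χ ψ : _ → Carrier) → (∀ y → P y → χ y ≈ ψ y) → Σ_ L χ ≈ Σ_ L ψ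

  seesOnly-applyUpTo : (n : ℕ) (f : ℕ → ℕ) (P : ℕ → Set) → (∀ i → i < n → P (f i)) → SeesOnly P (applyUpTo f n)
  seesOnly-applyUpTo zero    f P h χ ψ e = refl
  seesOnly-applyUpTo (suc n) f P h χ ψ e =
    +-cong (e _ (h 0 (s≤s z≤n))) (seesOnly-applyUpTo n (f ∘ suc) P (λ i le → h (suc i) (s≤s le)) χ ψ e)

  seesOnly-upTo : (n : ℕ) → SeesOnly (_< n) (upTo n)
  seesOnly-upTo n = seesOnly-applyUpTo n id _ (λ i le → le)

  Σ-applyUpTo : (n : ℕ) (f g : ℕ → ℕ) (χ : ℕ → Carrier) →
    Σ_ (applyUpTo (g ∘ f) n) χ ≡ Σ_ (applyUpTo f n) (χ ∘ g)
  Σ-applyUpTo zero    f g χ = P.refl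
  Σ-applyUpTo (suc n) f g χ = P.cong (χ (g (f 0)) +_) (Σ-applyUpTo n (f ∘ suc) g χ)

  Σ-upTo-first : ∀ n (χ : ℕ → Carrier) → Σ_ (upTo (suc n)) χ ≈ χ 0 + Σ_ (upTo n) (χ ∘ suc)
  Σ-upTo-first n χ = +-cong refl (reflexive (Σ-applyUpTo n id suc χ))

  Σ-upTo-last : ∀ n (χ : ℕ → Carrier) → Σ_ (upTo (suc n)) χ ≈ Σ_ (upTo n) χ + χ n
  Σ-upTo-last n χ = begin
    Σ_ (upTo (suc n)) χ          ≡⟨ P.cong (λ L → Σ_ L χ) (P.sym (upTo-∷ʳ n)) ⟩
    Σ_ (upTo n ++ (n ∷ [])) χ    ≈⟨ Σ-++ (upTo n) _ χ ⟩
    Σ_ (upTo n) χ + (χ n + 0#)   ≈⟨ +-cong refl (+-identityʳ _) ⟩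
    Σ_ (upTo n) χ + χ n          ∎

  Σ-upTo-delta : (m x : ℕ) → x ≤ m → (χ : ℕ → Carrier) → (∀ y → y < suc m → y ≢ x → χ y ≈ 0#) →
    Σ_ (upTo (suc m)) χ ≈ χ x
  Σ-upTo-delta zero    .zero z≤n χ h = +-identityʳ _
  Σ-upTo-delta (suc m) x     le  χ h = trans (Σ-upTo-last (suc m) χ) (split (NP.m≤n⇒m<n∨m≡n le))
    where
    below-m : ∀ y → y < suc m → y < suc (suc m)
    below-m y le' = NP.m≤n⇒m≤1+n le'
    split : x < suc m ⊎ x ≡ suc m → Σ_ (upTo (suc m)) χ + χ (suc m) ≈ χ x
    split (inj₁ (s≤s x≤m)) = trans
      (+-cong (Σ-upTo-delta m x x≤m χ (λ y le' → h y (below-m y le')))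
              (h (suc m) NP.≤-refl (λ e → NP.<⇒≢ (s≤s x≤m) (P.sym e))))
      (+-identityʳ _)
    split (inj₂ P.refl) = trans
      (+-cong (trans (seesOnly-upTo (suc m) χ (λ _ → 0#) (λ y le' → h y (below-m y le') (NP.<⇒≢ le')))
                     (Σ-zero (upTo (suc m)) _ (λ _ → refl)))
              refl)
      (+-identityˡ _)

  Σ-piList : ∀ {A : Set} (n : ℕ) (L : Fin (suc n) → List A) (φ : (Fin (suc n) → A) → Carrier) →
    Σ_ (piList (suc n) L) φ ≈ Σ_ (L Fin.zero) (λ y → Σ_ (piList n (L ∘ Fin.suc)) (λ f → φ (y VF.∷ f)))
  Σ-piList n L φ = trans (Σ-concatMap (L Fin.zero) _ φ)
    (Σ-cong (L Fin.zero) (λ y → reflexive (Σ-map (piList n (L ∘ Fin.suc)) (y VF.∷_) φ)))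

  seesOnly-piList : ∀ {A : Set} (n : ℕ) (L : Fin n → List A) (Q : Fin n → A → Set) →
    (∀ i → SeesOnly (Q i) (L i)) → SeesOnly (λ f → ∀ i → Q i (f i)) (piList n L)
  seesOnly-piList zero    L Q h χ ψ e = +-cong (e _ (λ ())) refl
  seesOnly-piList (suc n) L Q h χ ψ e = begin
    Σ_ (piList (suc n) L) χ ≈⟨ Σ-piList n L χ ⟩
    Σ_ (L Fin.zero) (λ y → Σ_ (piList n (L ∘ Fin.suc)) (λ f → χ (y VF.∷ f)))
      ≈⟨ h Fin.zero _ _ (λ y qy → seesOnly-piList n (L ∘ Fin.suc) (Q ∘ Fin.suc) (h ∘ Fin.suc) _ _
           (λ f qf → e _ (λ { Fin.zero → qy ; (Fin.suc i) → qf i }))) ⟩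
    Σ_ (L Fin.zero) (λ y → Σ_ (piList n (L ∘ Fin.suc)) (λ f → ψ (y VF.∷ f))) ≈⟨ sym (Σ-piList n L ψ) ⟩
    Σ_ (piList (suc n) L) ψ ∎

  -- Reindexing and collapsing sums over piList, for summands that respect a
  -- relation _~_ on the coordinates (pointwise equality on rows, or ≡).
  module _ {A : Set} (_~_ : A → A → Set) (~refl : ∀ {y} → y ~ y) where

    Respects~ : (A → Carrier) → Set (ℓ ⊔ Level.zero)
    Respects~ χ = ∀ {y y'} → y ~ y' → χ y ≈ χ y'

    Respects~ⁿ : (n : ℕ) → ((Fin n → A) → Carrier) → Set (ℓ ⊔ Level.zero)
    Respects~ⁿ n φ = ∀ {f f'} → (∀ i → f i ~ f' i) → φ f ≈ φ f'

    piList-reindex : (n : ℕ) (p : Fin n) (L L' : Fin n → List A) (g : A → A) (Vanish : A → Set) →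
      (∀ i → i ≢ p → L i ≡ L' i) →
      (∀ χ → Respects~ χ → (∀ y → Vanish y → χ y ≈ 0#) → Σ_ (L p) χ ≈ Σ_ (L' p) (χ ∘ g)) →
      (φ : (Fin n → A) → Carrier) → Respects~ⁿ n φ → (∀ f → Vanish (f p) → φ f ≈ 0#) →
      Σ_ (piList n L) φ ≈ Σ_ (piList n L') (λ f → φ (updateAt f p g))
    piList-reindex (suc n) Fin.zero L L' g Vanish same step φ eφ vφ = begin
      Σ_ (piList (suc n) L) φ ≈⟨ Σ-piList n L φ ⟩
      Σ_ (L Fin.zero) (λ y → Σ_ (piList n (L ∘ Fin.suc)) (λ f → φ (y VF.∷ f)))
        ≈⟨ step _ (λ yy → Σ-cong (piList n (L ∘ Fin.suc)) (λ f → eφ (λ { Fin.zero → yy ; (Fin.suc i) → ~refl })))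
                  (λ y vy → Σ-zero (piList n (L ∘ Fin.suc)) _ (λ f → vφ _ vy)) ⟩
      Σ_ (L' Fin.zero) (λ y → Σ_ (piList n (L ∘ Fin.suc)) (λ f → φ (g y VF.∷ f)))
        ≡⟨ P.cong (λ M → Σ_ (L' Fin.zero) (λ y → Σ_ M (λ f → φ (g y VF.∷ f))))
                  (piList-cong n (λ i → same (Fin.suc i) (λ ()))) ⟩
      Σ_ (L' Fin.zero) (λ y → Σ_ (piList n (L' ∘ Fin.suc)) (λ f → φ (g y VF.∷ f)))
        ≈⟨ Σ-cong (L' Fin.zero) (λ y → Σ-cong (piList n (L' ∘ Fin.suc))
             (λ f → eφ (λ { Fin.zero → ~refl ; (Fin.suc i) → ~refl }))) ⟩
      Σ_ (L' Fin.zero) (λ y → Σ_ (piList n (L' ∘ Fin.suc)) (λ f → φ (updateAt (y VF.∷ f) Fin.zero g)))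
        ≈⟨ sym (Σ-piList n L' _) ⟩
      Σ_ (piList (suc n) L') (λ f → φ (updateAt f Fin.zero g)) ∎
    piList-reindex (suc n) (Fin.suc p) L L' g Vanish same step φ eφ vφ = begin
      Σ_ (piList (suc n) L) φ ≈⟨ Σ-piList n L φ ⟩
      Σ_ (L Fin.zero) (λ y → Σ_ (piList n (L ∘ Fin.suc)) (λ f → φ (y VF.∷ f)))
        ≈⟨ Σ-cong (L Fin.zero) (λ y → piList-reindex n p (L ∘ Fin.suc) (L' ∘ Fin.suc) g Vanish
             (λ i ne → same (Fin.suc i) (ne ∘ suc-injective)) step
             (λ f → φ (y VF.∷ f)) (λ ff → eφ (λ { Fin.zero → ~refl ; (Fin.suc i) → ff i }))
             (λ f vf → vφ _ vf)) ⟩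
      Σ_ (L Fin.zero) (λ y → Σ_ (piList n (L' ∘ Fin.suc)) (λ f → φ (y VF.∷ updateAt f p g)))
        ≡⟨ P.cong (λ M → Σ_ M (λ y → Σ_ (piList n (L' ∘ Fin.suc)) (λ f → φ (y VF.∷ updateAt f p g))))
                  (same Fin.zero (λ ())) ⟩
      Σ_ (L' Fin.zero) (λ y → Σ_ (piList n (L' ∘ Fin.suc)) (λ f → φ (y VF.∷ updateAt f p g)))
        ≈⟨ Σ-cong (L' Fin.zero) (λ y → Σ-cong (piList n (L' ∘ Fin.suc))
             (λ f → eφ (λ { Fin.zero → ~refl ; (Fin.suc i) → ~refl }))) ⟩
      Σ_ (L' Fin.zero) (λ y → Σ_ (piList n (L' ∘ Fin.suc)) (λ f → φ (updateAt (y VF.∷ f) (Fin.suc p) g)))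
        ≈⟨ sym (Σ-piList n L' _) ⟩
      Σ_ (piList (suc n) L') (λ f → φ (updateAt f (Fin.suc p) g)) ∎

    piList-delta : (n : ℕ) (L : Fin n → List A) (x : Fin n → A) (Q : Fin n → A → Set) →
      (∀ i → Q i (x i)) → (∀ i → SeesOnly (Q i) (L i)) →
      (∀ i χ → Respects~ χ → (∀ y → Q i y → ¬ (y ~ x i) → χ y ≈ 0#) → Σ_ (L i) χ ≈ χ (x i)) →
      (φ : (Fin n → A) → Carrier) → Respects~ⁿ n φ →
      (∀ f → (∀ i → Q i (f i)) → ¬ (∀ i → f i ~ x i) → φ f ≈ 0#) →
      Σ_ (piList n L) φ ≈ φ x
    piList-delta zero    L x Q qx sees step φ eφ vφ = trans (+-identityʳ _) (eφ (λ ()))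
    piList-delta (suc n) L x Q qx sees step φ eφ vφ = begin
      Σ_ (piList (suc n) L) φ ≈⟨ Σ-piList n L φ ⟩
      Σ_ (L Fin.zero) (λ y → Σ_ (piList n (L ∘ Fin.suc)) (λ f → φ (y VF.∷ f)))
        ≈⟨ step Fin.zero _ (λ yy → Σ-cong (piList n (L ∘ Fin.suc)) (λ f → eφ (λ { Fin.zero → yy ; (Fin.suc i) → ~refl })))
             (λ y qy ny → trans (seesOnly-piList n (L ∘ Fin.suc) (Q ∘ Fin.suc) (sees ∘ Fin.suc) _ (λ _ → 0#)
                  (λ f qf → vφ _ (λ { Fin.zero → qy ; (Fin.suc i) → qf i }) (λ all → ny (all Fin.zero))))
                (Σ-zero (piList n (L ∘ Fin.suc)) _ (λ _ → refl))) ⟩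
      Σ_ (piList n (L ∘ Fin.suc)) (λ f → φ (x Fin.zero VF.∷ f))
        ≈⟨ piList-delta n (L ∘ Fin.suc) (x ∘ Fin.suc) (Q ∘ Fin.suc) (qx ∘ Fin.suc) (sees ∘ Fin.suc) (step ∘ Fin.suc) _
             (λ ff → eφ (λ { Fin.zero → ~refl ; (Fin.suc i) → ff i }))
             (λ f qf nall → vφ _ (λ { Fin.zero → qx Fin.zero ; (Fin.suc i) → qf i }) (λ all → nall (all ∘ Fin.suc))) ⟩
      φ (x Fin.zero VF.∷ (x ∘ Fin.suc)) ≈⟨ eφ (λ { Fin.zero → ~refl ; (Fin.suc i) → ~refl }) ⟩
      φ x ∎

  ExtM : (Mono k → Carrier) → Set ℓ
  ExtM ψ = ∀ {d d'} → d ≗ᴹ d' → ψ d ≈ ψ d'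

  _≗ʳ_ : (Fin k → ℕ) → (Fin k → ℕ) → Set
  row ≗ʳ row' = ∀ j → row j ≡ row' j

  ≗ʳ-refl : ∀ {row} → row ≗ʳ row
  ≗ʳ-refl j = P.refl

  InBox : Mono k → Mono k → Set
  InBox e d = ∀ i j → d i j < suc (e i j)

  below-cong : ∀ {d d'} → d ≗ᴹ d' → below d ≡ below d'
  below-cong h = piList-cong k (λ i → piList-cong k (λ j → P.cong (λ m → upTo (suc m)) (h i j)))

  seesOnly-below : (e : Mono k) → SeesOnly (InBox e) (below e)
  seesOnly-below e = seesOnly-piList k _ _ (λ i → seesOnly-piList k _ _ (λ j → seesOnly-upTo (suc (e i j))))

  private
    raiseRow : Fin k → (Fin k → ℕ) → Fin k → ℕ
    raiseRow q row = updateAt row q suc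

    box-rows : ∀ (e : Mono k) p q i → i ≢ p →
      piList k (λ j → upTo (suc (incr e p q i j))) ≡ piList k (λ j → upTo (suc (e i j)))
    box-rows e p q i ne = piList-cong k (λ j → P.cong (λ m → upTo (suc m))
      (P.cong (λ r → r j) (updateAt-minimal i p e ne)))

    box-cells : ∀ (e : Mono k) p q j → j ≢ q → upTo (suc (updateAt (e p) q suc j)) ≡ upTo (suc (e p j))
    box-cells e p q j ne = P.cong (λ m → upTo (suc m)) (updateAt-minimal j q (e p) ne)

    updateAt-id-nested : ∀ (d : Mono k) p q → updateAt d p (λ row → updateAt row q id) ≗ᴹ d
    updateAt-id-nested d p q i j with i ≟ p
    ... | yes P.refl rewrite updateAt-updates p {λ row → updateAt row q id} d = updateAt-id q (d p) j
    ... | no ip = P.cong (λ row → row j) (updateAt-minimal i p d ip)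

  below-shift : (e : Mono k) (p q : Fin k) (ψ : Mono k → Carrier) → ExtM ψ → (∀ d → d p q ≡ 0 → ψ d ≈ 0#) →
    Σ_ (below (incr e p q)) ψ ≈ Σ_ (below e) (λ d → ψ (incr d p q))
  below-shift e p q ψ eψ vψ =
    piList-reindex _≗ʳ_ ≗ʳ-refl k p _ _ (raiseRow q) (λ row → row q ≡ 0) (box-rows e p q) rowStep ψ eψ vψ
    where
    rowStep : ∀ χ → Respects~ _≗ʳ_ ≗ʳ-refl χ → (∀ row → row q ≡ 0 → χ row ≈ 0#) →
      Σ_ (piList k (λ j → upTo (suc (incr e p q p j)))) χ ≈ Σ_ (piList k (λ j → upTo (suc (e p j)))) (χ ∘ raiseRow q)
    rowStep χ eχ vχ rewrite updateAt-updates p {raiseRow q} e =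
      piList-reindex _≡_ P.refl k q _ _ suc (_≡ 0) (box-cells e p q)
        (λ χ₁ _ v₁ → P.subst (λ m → Σ_ (upTo (suc m)) χ₁ ≈ Σ_ (upTo (suc (e p q))) (χ₁ ∘ suc))
           (P.sym (updateAt-updates q (e p))) (trans (Σ-upTo-first (suc (e p q)) χ₁) (trans (+-cong (v₁ 0 P.refl) refl) (+-identityˡ _))))
        χ eχ vχ

  below-slice : (e : Mono k) (p q : Fin k) (ψ : Mono k → Carrier) → ExtM ψ → (∀ d → d p q ≡ suc (e p q) → ψ d ≈ 0#) →
    Σ_ (below (incr e p q)) ψ ≈ Σ_ (below e) ψ
  below-slice e p q ψ eψ vψ = trans
    (piList-reindex _≗ʳ_ ≗ʳ-refl k p _ _ (λ row → updateAt row q id) (λ row → row q ≡ suc (e p q))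
       (box-rows e p q) rowStep ψ eψ vψ)
    (Σ-cong (below e) (λ d → eψ (updateAt-id-nested d p q)))
    where
    rowStep : ∀ χ → Respects~ _≗ʳ_ ≗ʳ-refl χ → (∀ row → row q ≡ suc (e p q) → χ row ≈ 0#) →
      Σ_ (piList k (λ j → upTo (suc (incr e p q p j)))) χ ≈ Σ_ (piList k (λ j → upTo (suc (e p j)))) (λ row → χ (updateAt row q id))
    rowStep χ eχ vχ rewrite updateAt-updates p {raiseRow q} e =
      piList-reindex _≡_ P.refl k q _ _ id (_≡ suc (e p q)) (box-cells e p q)
        (λ χ₁ _ v₁ → P.subst (λ m → Σ_ (upTo (suc m)) χ₁ ≈ Σ_ (upTo (suc (e p q))) χ₁)
           (P.sym (updateAt-updates q (e p)))
           (trans (Σ-upTo-last (suc (e p q)) χ₁) (trans (+-cong refl (v₁ _ P.refl)) (+-identityʳ _))))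
        χ eχ vχ

  below-delta : (e x : Mono k) → (∀ i j → x i j ≤ e i j) → (ψ : Mono k → Carrier) → ExtM ψ →
    (∀ d → InBox e d → ¬ (d ≗ᴹ x) → ψ d ≈ 0#) → Σ_ (below e) ψ ≈ ψ x
  below-delta e x le ψ eψ vψ =
    piList-delta _≗ʳ_ ≗ʳ-refl k _ x (λ i row → ∀ j → row j < suc (e i j)) (λ i j → s≤s (le i j))
      (λ i → seesOnly-piList k _ _ (λ j → seesOnly-upTo (suc (e i j))))
      (λ i χ eχ vχ → piList-delta _≡_ P.refl k _ (x i) (λ j y → y < suc (e i j)) (λ j → s≤s (le i j))
          (λ j → seesOnly-upTo (suc (e i j)))
          (λ j χ₁ _ v₁ → Σ-upTo-delta (e i j) (x i j) (le i j) χ₁ v₁)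
          χ eχ vχ)
      ψ eψ vψ

  infix 4 _≋_
  _≋_ : PS → PS → Set ℓ
  F ≋ G = ∀ e → F e ≈ G e

  ≋-refl : ∀ {F} → F ≋ F
  ≋-refl e = refl

  ≋-sym : ∀ {F G} → F ≋ G → G ≋ F
  ≋-sym h e = sym (h e)

  ≋-trans : ∀ {F G H} → F ≋ G → G ≋ H → F ≋ H
  ≋-trans h h' e = trans (h e) (h' e)

  fromℕR-+ : ∀ m n → fromℕR (m ℕ.+ n) ≈ fromℕR m + fromℕR n
  fromℕR-+ zero    n = sym (+-identityˡ _)
  fromℕR-+ (suc m) n = trans (+-cong refl (fromℕR-+ m n)) (sym (+-assoc _ _ _))

  fromℕR-* : ∀ m n → fromℕR (m ℕ.* n) ≈ fromℕR m * fromℕR n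
  fromℕR-* zero    n = sym (zeroˡ _)
  fromℕR-* (suc m) n = begin
    fromℕR (n ℕ.+ m ℕ.* n)             ≈⟨ fromℕR-+ n (m ℕ.* n) ⟩
    fromℕR n + fromℕR (m ℕ.* n)        ≈⟨ +-cong (sym (*-identityˡ _)) (fromℕR-* m n) ⟩
    1# * fromℕR n + fromℕR m * fromℕR n ≈⟨ sym (distribʳ _ _ _) ⟩
    (1# + fromℕR m) * fromℕR n          ∎

  constPS-ext : ∀ x → ExtM (constPS x)
  constPS-ext x h = reflexive (P.cong (λ b → if b then x else 0#) (isZeroM-cong h))

  zeroPS-ext : ExtM zeroPS
  zeroPS-ext = constPS-ext 0#

  onePS-ext : ExtM onePS
  onePS-ext = constPS-ext 1#

  var-ext : ∀ a b → ExtM (var a b)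
  var-ext a b h = reflexive (P.cong (λ z → if z then 1# else 0#) (isUnitM-cong a b h))

  symVar-ext : ∀ a b → ExtM (symVar a b)
  symVar-ext a b with lt a b
  ... | true  = var-ext a b
  ... | false = var-ext b a

  ⊕-ext : ∀ {F G} → ExtM F → ExtM G → ExtM (F ⊕ G)
  ⊕-ext eF eG h = +-cong (eF h) (eG h)

  scale-ext : ∀ x {F} → ExtM F → ExtM (scale x F)
  scale-ext x eF h = *-cong refl (eF h)

  ⊗-ext : ∀ F {G} → ExtM G → ExtM (F ⊗ G)
  ⊗-ext F {G} eG {e} {e'} h = trans
    (Σ-cong (below e) (λ d → *-cong refl (eG (λ i j → P.cong (_∸ d i j) (h i j)))))
    (reflexive (P.cong (λ L → Σ_ L (λ d → F d * G (e' ∸ᴹ d))) (below-cong h)))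

  powPS-ext : ∀ F → ExtM F → ∀ m → ExtM (powPS F m)
  powPS-ext F eF zero    = onePS-ext
  powPS-ext F eF (suc m) = ⊗-ext (powPS F m) eF

  sumFinPS-ext : ∀ n (f : Fin n → PS) → (∀ i → ExtM (f i)) → ExtM (sumFinPS n f)
  sumFinPS-ext zero    f ef = zeroPS-ext
  sumFinPS-ext (suc n) f ef = ⊕-ext (ef Fin.zero) (sumFinPS-ext n (f ∘ Fin.suc) (ef ∘ Fin.suc))

  prodFinPS-ext : ∀ n (f : Fin n → PS) → (∀ i → ExtM (f i)) → ExtM (prodFinPS n f)
  prodFinPS-ext zero    f ef = onePS-ext
  prodFinPS-ext (suc n) f ef = ⊗-ext (f Fin.zero) (prodFinPS-ext n (f ∘ Fin.suc) (ef ∘ Fin.suc))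

  ExtΦ : (Mono k → PS) → Set ℓ
  ExtΦ Φ = ∀ {d d' x x'} → d ≗ᴹ d' → x ≗ᴹ x' → Φ d x ≈ Φ d' x'

  upperPart : (Mono k → PS) → Mono k → Mono k → Carrier
  upperPart Φ d x = if isUpper d then Φ d x else 0#

  upperPart-ext : ∀ Φ → ExtΦ Φ → ExtΦ (λ d x → upperPart Φ d x)
  upperPart-ext Φ eΦ {d} {d'} h h' with isUpper d | isUpper d' | isUpper-cong h
  ... | true  | true  | _ = eΦ h h'
  ... | false | false | _ = refl

  sumX-ext : ∀ Φ → ExtΦ Φ → ExtM (sumX Φ)
  sumX-ext Φ eΦ {e} {e'} h = trans
    (Σ-cong (below e) (λ d → upperPart-ext Φ eΦ (λ i j → P.refl) (λ i j → P.cong (_∸ d i j) (h i j))))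
    (reflexive (P.cong (λ L → Σ_ L (λ d → upperPart Φ d (e' ∸ᴹ d))) (below-cong h)))

  constPS-cong : ∀ {x y} → x ≈ y → constPS x ≋ constPS y
  constPS-cong h e with isZeroM e
  ... | true  = h
  ... | false = refl

  ⊗-cong : ∀ {F F' G G'} → F ≋ F' → G ≋ G' → (F ⊗ G) ≋ (F' ⊗ G')
  ⊗-cong hF hG e = Σ-cong (below e) (λ d → *-cong (hF d) (hG _))

  ⊗-congˡ : ∀ {F F'} G → F ≋ F' → (F ⊗ G) ≋ (F' ⊗ G)
  ⊗-congˡ G h = ⊗-cong h (≋-refl {G})

  ⊗-congʳ : ∀ F {G G'} → G ≋ G' → (F ⊗ G) ≋ (F ⊗ G')
  ⊗-congʳ F h = ⊗-cong (≋-refl {F}) h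

  ⊕-cong : ∀ {F F' G G'} → F ≋ F' → G ≋ G' → (F ⊕ G) ≋ (F' ⊕ G')
  ⊕-cong hF hG e = +-cong (hF e) (hG e)

  scale-cong : ∀ {x x' F F'} → x ≈ x' → F ≋ F' → scale x F ≋ scale x' F'
  scale-cong hx hF e = *-cong hx (hF e)

  sumFinPS-cong : ∀ n {f g : Fin n → PS} → (∀ i → f i ≋ g i) → sumFinPS n f ≋ sumFinPS n g
  sumFinPS-cong zero    h = ≋-refl
  sumFinPS-cong (suc n) h = ⊕-cong (h Fin.zero) (sumFinPS-cong n (h ∘ Fin.suc))

  prodFinPS-cong : ∀ n {f g : Fin n → PS} → (∀ i → f i ≋ g i) → prodFinPS n f ≋ prodFinPS n g
  prodFinPS-cong zero    h = ≋-refl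
  prodFinPS-cong (suc n) h = ⊗-cong (h Fin.zero) (prodFinPS-cong n (h ∘ Fin.suc))

  sumX-cong : ∀ {F G : Mono k → PS} → (∀ d → F d ≋ G d) → sumX F ≋ sumX G
  sumX-cong {F} {G} h e = Σ-cong (below e) upper
    where
    upper : ∀ d → upperPart F d (e ∸ᴹ d) ≈ upperPart G d (e ∸ᴹ d)
    upper d with isUpper d
    ... | true  = h d _
    ... | false = refl

  zeroPS≈ : ∀ e → zeroPS e ≈ 0#
  zeroPS≈ e with isZeroM e
  ... | true  = refl
  ... | false = refl

  ⊕-identityˡ : ∀ F → (zeroPS ⊕ F) ≋ F
  ⊕-identityˡ F e = trans (+-cong (zeroPS≈ e) refl) (+-identityˡ _)

  ⊕-identityʳ : ∀ F → (F ⊕ zeroPS) ≋ F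
  ⊕-identityʳ F e = trans (+-cong refl (zeroPS≈ e)) (+-identityʳ _)

  ⊗-zeroˡ : ∀ G → (zeroPS ⊗ G) ≋ zeroPS
  ⊗-zeroˡ G e = trans (Σ-zero (below e) _ (λ d → trans (*-cong (zeroPS≈ d) refl) (zeroˡ _))) (sym (zeroPS≈ e))

  ⊗-zeroʳ : ∀ F → (F ⊗ zeroPS) ≋ zeroPS
  ⊗-zeroʳ F e = trans (Σ-zero (below e) _ (λ d → trans (*-cong refl (zeroPS≈ (e ∸ᴹ d))) (zeroʳ _))) (sym (zeroPS≈ e))

  ⊗-distribˡ : ∀ F G H → (F ⊗ (G ⊕ H)) ≋ ((F ⊗ G) ⊕ (F ⊗ H))
  ⊗-distribˡ F G H e = trans (Σ-cong (below e) (λ d → distribˡ _ _ _)) (Σ-+ (below e) _ _)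

  ⊗-scaleˡ : ∀ a F G → (scale a F ⊗ G) ≋ scale a (F ⊗ G)
  ⊗-scaleˡ a F G e = trans (Σ-cong (below e) (λ d → *-assoc _ _ _)) (Σ-*ˡ (below e) a _)

  ⊗-scaleʳ : ∀ a F G → (F ⊗ scale a G) ≋ scale a (F ⊗ G)
  ⊗-scaleʳ a F G e = trans (Σ-cong (below e) (λ d → x*[a*y]≈a*[x*y] _ _ _)) (Σ-*ˡ (below e) a _)
    where
    x*[a*y]≈a*[x*y] : ∀ x a y → x * (a * y) ≈ a * (x * y)
    x*[a*y]≈a*[x*y] x a y = trans (sym (*-assoc _ _ _)) (trans (*-cong (*-comm _ _) refl) (*-assoc _ _ _))

  scale-scale : ∀ a b F → scale a (scale b F) ≋ scale (a * b) F
  scale-scale a b F e = sym (*-assoc _ _ _)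

  scale-⊕ : ∀ a b F → (scale a F ⊕ scale b F) ≋ scale (a + b) F
  scale-⊕ a b F e = sym (distribʳ _ _ _)

  scale-0# : ∀ F → scale 0# F ≋ zeroPS
  scale-0# F e = trans (zeroˡ _) (sym (zeroPS≈ e))

  scale-const : ∀ a x → scale a (constPS x) ≋ constPS (a * x)
  scale-const a x e with isZeroM e
  ... | true  = refl
  ... | false = zeroʳ _

  const-+ : ∀ x y → (constPS x ⊕ constPS y) ≋ constPS (x + y)
  const-+ x y e with isZeroM e
  ... | true  = refl
  ... | false = +-identityʳ _

  ⊗-constʳ : ∀ F → ExtM F → ∀ γ → (F ⊗ constPS γ) ≋ scale γ F
  ⊗-constʳ F eF γ e = trans
    (below-delta e e (λ i j → NP.≤-refl) _ (λ h → *-cong (eF h) (constPS-ext γ (λ i j → P.cong (e i j ∸_) (h i j)))) off)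
    (trans (*-cong refl (reflexive (P.cong (λ b → if b then γ else 0#) (isZeroM-intro (e ∸ᴹ e) (λ i j → NP.n∸n≡0 (e i j))))))
           (*-comm _ _))
    where
    off : ∀ d → InBox e d → ¬ (d ≗ᴹ e) → F d * constPS γ (e ∸ᴹ d) ≈ 0#
    off d le nd with isZeroM (e ∸ᴹ d) in eq
    ... | true  = ⊥-elim (nd (λ i j → NP.≤-antisym (NP.≤-pred (le i j)) (NP.m∸n≡0⇒m≤n (isZeroM-sound (e ∸ᴹ d) eq i j))))
    ... | false = zeroʳ _

  ⊗-constˡ : ∀ F → ExtM F → ∀ γ → (constPS γ ⊗ F) ≋ scale γ F
  ⊗-constˡ F eF γ e = trans
    (below-delta e zeroM (λ i j → z≤n) _ (λ h → *-cong (constPS-ext γ h) (eF (λ i j → P.cong (e i j ∸_) (h i j)))) off)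
    (*-cong (reflexive (P.cong (λ b → if b then γ else 0#) (isZeroM-intro zeroM (λ i j → P.refl)))) refl)
    where
    off : ∀ d → InBox e d → ¬ (d ≗ᴹ zeroM) → constPS γ d * F (e ∸ᴹ d) ≈ 0#
    off d le nd with isZeroM d in eq
    ... | true  = ⊥-elim (nd (isZeroM-sound d eq))
    ... | false = zeroˡ _

  sumX-⊕ : ∀ (F G : Mono k → PS) → sumX (λ d → F d ⊕ G d) ≋ (sumX F ⊕ sumX G)
  sumX-⊕ F G e = trans (Σ-cong (below e) split) (Σ-+ (below e) _ _)
    where
    split : ∀ d → upperPart (λ d → F d ⊕ G d) d (e ∸ᴹ d) ≈ upperPart F d (e ∸ᴹ d) + upperPart G d (e ∸ᴹ d)
    split d with isUpper d
    ... | true  = refl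
    ... | false = sym (+-identityʳ _)

  sumX-scale : ∀ a (F : Mono k → PS) → sumX (λ d → scale a (F d)) ≋ scale a (sumX F)
  sumX-scale a F e = trans (Σ-cong (below e) pull) (Σ-*ˡ (below e) a _)
    where
    pull : ∀ d → upperPart (λ d → scale a (F d)) d (e ∸ᴹ d) ≈ a * upperPart F d (e ∸ᴹ d)
    pull d with isUpper d
    ... | true  = refl
    ... | false = sym (zeroʳ _)

  sumX-zero : sumX (λ d → zeroPS) ≋ zeroPS
  sumX-zero e = trans (Σ-zero (below e) _ vanish) (sym (zeroPS≈ e))
    where
    vanish : ∀ d → upperPart (λ d → zeroPS) d (e ∸ᴹ d) ≈ 0#
    vanish d with isUpper d
    ... | true  = zeroPS≈ (e ∸ᴹ d)
    ... | false = refl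

  sumX-const-+ : ∀ (f g : Mono k → Carrier) → sumX (λ d → constPS (f d + g d)) ≋ (sumX (λ d → constPS (f d)) ⊕ sumX (λ d → constPS (g d)))
  sumX-const-+ f g = ≋-trans (sumX-cong (λ d → ≋-sym (const-+ (f d) (g d)))) (sumX-⊕ (λ d → constPS (f d)) (λ d → constPS (g d)))

  sumX-const-* : ∀ α (f : Mono k → Carrier) → sumX (λ d → constPS (α * f d)) ≋ scale α (sumX (λ d → constPS (f d)))
  sumX-const-* α f = ≋-trans (sumX-cong (λ d → ≋-sym (scale-const α (f d)))) (sumX-scale α (λ d → constPS (f d)))

  sumFinR-zero : ∀ n (f : Fin n → Carrier) → (∀ j → f j ≈ 0#) → sumFinR n f ≈ 0#
  sumFinR-zero zero    f h = refl
  sumFinR-zero (suc n) f h = trans (+-cong (h Fin.zero) (sumFinR-zero n (f ∘ Fin.suc) (h ∘ Fin.suc))) (+-identityʳ _)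

  sumFinR-delta : ∀ n (f : Fin n → Carrier) x → (∀ j → j ≢ x → f j ≈ 0#) → sumFinR n f ≈ f x
  sumFinR-delta (suc n) f Fin.zero    h =
    trans (+-cong refl (sumFinR-zero n (f ∘ Fin.suc) (λ j → h (Fin.suc j) (λ ())))) (+-identityʳ _)
  sumFinR-delta (suc n) f (Fin.suc x) h =
    trans (+-cong (h Fin.zero (λ ())) (sumFinR-delta n (f ∘ Fin.suc) x (λ j ne → h (Fin.suc j) (ne ∘ suc-injective))))
          (+-identityˡ _)

  prodFinR-cong : ∀ n {f g : Fin n → Carrier} → (∀ i → f i ≈ g i) → prodFinR n f ≈ prodFinR n g
  prodFinR-cong zero    h = refl
  prodFinR-cong (suc n) h = *-cong (h Fin.zero) (prodFinR-cong n (h ∘ Fin.suc))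

  prodFinR-one : ∀ n (f : Fin n → Carrier) → (∀ i → f i ≈ 1#) → prodFinR n f ≈ 1#
  prodFinR-one zero    f h = refl
  prodFinR-one (suc n) f h = trans (*-cong (h Fin.zero) (prodFinR-one n (f ∘ Fin.suc) (h ∘ Fin.suc))) (*-identityˡ _)

  private
    x*[y*z]≈y*[x'*z] : ∀ {x x' y z} → x ≈ x' → x * (y * z) ≈ y * (x' * z)
    x*[y*z]≈y*[x'*z] e = trans (sym (*-assoc _ _ _)) (trans (*-cong (trans (*-comm _ _) (*-cong refl e)) refl) (*-assoc _ _ _))

  prodFinR-absorb : ∀ n (f g : Fin n → Carrier) p x → (∀ i → i ≢ p → f i ≈ g i) → x * f p ≈ g p →
    x * prodFinR n f ≈ prodFinR n g
  prodFinR-absorb (suc n) f g Fin.zero    x ho hp =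
    trans (sym (*-assoc _ _ _)) (*-cong hp (prodFinR-cong n (λ i → ho (Fin.suc i) (λ ()))))
  prodFinR-absorb (suc n) f g (Fin.suc p) x ho hp = trans (x*[y*z]≈y*[x'*z] refl)
    (*-cong (ho Fin.zero (λ ())) (prodFinR-absorb n (f ∘ Fin.suc) (g ∘ Fin.suc) p x (λ i ne → ho (Fin.suc i) (ne ∘ suc-injective)) hp))

  prodFinR-linear : ∀ n (f g h : Fin n → Carrier) p α β → (∀ i → i ≢ p → f i ≈ g i) → (∀ i → i ≢ p → f i ≈ h i) →
    f p ≈ α * g p + β * h p → prodFinR n f ≈ α * prodFinR n g + β * prodFinR n h
  prodFinR-linear (suc n) f g h Fin.zero α β hg hh hp = begin
    f Fin.zero * prodFinR n (f ∘ Fin.suc)                          ≈⟨ *-cong hp refl ⟩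
    (α * g Fin.zero + β * h Fin.zero) * prodFinR n (f ∘ Fin.suc)   ≈⟨ distribʳ _ _ _ ⟩
    α * g Fin.zero * prodFinR n (f ∘ Fin.suc) + β * h Fin.zero * prodFinR n (f ∘ Fin.suc)
      ≈⟨ +-cong (trans (*-assoc _ _ _) (*-cong refl (*-cong refl (prodFinR-cong n (λ i → hg (Fin.suc i) (λ ()))))))
                (trans (*-assoc _ _ _) (*-cong refl (*-cong refl (prodFinR-cong n (λ i → hh (Fin.suc i) (λ ())))))) ⟩
    α * prodFinR (suc n) g + β * prodFinR (suc n) h ∎
  prodFinR-linear (suc n) f g h (Fin.suc p) α β hg hh hp = begin
    f Fin.zero * prodFinR n (f ∘ Fin.suc)
      ≈⟨ *-cong refl (prodFinR-linear n (f ∘ Fin.suc) (g ∘ Fin.suc) (h ∘ Fin.suc) p α β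
           (λ i ne → hg (Fin.suc i) (ne ∘ suc-injective)) (λ i ne → hh (Fin.suc i) (ne ∘ suc-injective)) hp) ⟩
    f Fin.zero * (α * prodFinR n (g ∘ Fin.suc) + β * prodFinR n (h ∘ Fin.suc)) ≈⟨ distribˡ _ _ _ ⟩
    f Fin.zero * (α * prodFinR n (g ∘ Fin.suc)) + f Fin.zero * (β * prodFinR n (h ∘ Fin.suc))
      ≈⟨ +-cong (x*[y*z]≈y*[x'*z] (hg Fin.zero (λ ()))) (x*[y*z]≈y*[x'*z] (hh Fin.zero (λ ()))) ⟩
    α * prodFinR (suc n) g + β * prodFinR (suc n) h ∎

  sumFinPS-zero : ∀ n (f : Fin n → PS) → (∀ j → f j ≋ zeroPS) → sumFinPS n f ≋ zeroPS
  sumFinPS-zero zero    f h = ≋-refl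
  sumFinPS-zero (suc n) f h = ≋-trans (⊕-cong (h Fin.zero) (sumFinPS-zero n (f ∘ Fin.suc) (h ∘ Fin.suc))) (⊕-identityʳ _)

  sumFinPS-delta : ∀ n (f : Fin n → PS) x → (∀ j → j ≢ x → f j ≋ zeroPS) → sumFinPS n f ≋ f x
  sumFinPS-delta (suc n) f Fin.zero    h =
    ≋-trans (⊕-cong ≋-refl (sumFinPS-zero n (f ∘ Fin.suc) (λ j → h (Fin.suc j) (λ ())))) (⊕-identityʳ _)
  sumFinPS-delta (suc n) f (Fin.suc x) h =
    ≋-trans (⊕-cong (h Fin.zero (λ ())) (sumFinPS-delta n (f ∘ Fin.suc) x (λ j ne → h (Fin.suc j) (ne ∘ suc-injective))))
            (⊕-identityˡ _)

  sumFinPS-two : ∀ n (f : Fin n → PS) x y → x ≢ y → (∀ j → j ≢ x → j ≢ y → f j ≋ zeroPS) → sumFinPS n f ≋ (f x ⊕ f y)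
  sumFinPS-two (suc n) f Fin.zero    Fin.zero    x≢y h = ⊥-elim (x≢y P.refl)
  sumFinPS-two (suc n) f Fin.zero    (Fin.suc y) x≢y h =
    ⊕-cong ≋-refl (sumFinPS-delta n (f ∘ Fin.suc) y (λ j ne → h (Fin.suc j) (λ ()) (ne ∘ suc-injective)))
  sumFinPS-two (suc n) f (Fin.suc x) Fin.zero    x≢y h =
    ≋-trans (⊕-cong ≋-refl (sumFinPS-delta n (f ∘ Fin.suc) x (λ j ne → h (Fin.suc j) (ne ∘ suc-injective) (λ ()))))
            (λ e → +-comm _ _)
  sumFinPS-two (suc n) f (Fin.suc x) (Fin.suc y) x≢y h =
    ≋-trans (⊕-cong (h Fin.zero (λ ()) (λ ()))
                    (sumFinPS-two n (f ∘ Fin.suc) x y (x≢y ∘ P.cong Fin.suc) (λ j jx jy → h (Fin.suc j) (jx ∘ suc-injective) (jy ∘ suc-injective))))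
            (⊕-identityˡ _)

  ⊗-sumFinPS : ∀ F n (h : Fin n → PS) → (F ⊗ sumFinPS n h) ≋ sumFinPS n (λ i → F ⊗ h i)
  ⊗-sumFinPS F zero    h = ⊗-zeroʳ F
  ⊗-sumFinPS F (suc n) h = ≋-trans (⊗-distribˡ F (h Fin.zero) (sumFinPS n (h ∘ Fin.suc)))
    (⊕-cong ≋-refl (⊗-sumFinPS F n (h ∘ Fin.suc)))

  prodFinPS-scale : ∀ n (f g : Fin n → PS) (γ : Fin n → Carrier) → (∀ i → f i ≋ scale (γ i) (g i)) →
    prodFinPS n f ≋ scale (prodFinR n γ) (prodFinPS n g)
  prodFinPS-scale zero    f g γ h e = sym (*-identityˡ _)
  prodFinPS-scale (suc n) f g γ h =
    ≋-trans (⊗-cong (h Fin.zero) (prodFinPS-scale n (f ∘ Fin.suc) (g ∘ Fin.suc) (γ ∘ Fin.suc) (h ∘ Fin.suc)))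
    (≋-trans (⊗-scaleˡ (γ Fin.zero) (g Fin.zero) (scale (prodFinR n (γ ∘ Fin.suc)) (prodFinPS n (g ∘ Fin.suc))))
    (≋-trans (scale-cong refl (⊗-scaleʳ (prodFinR n (γ ∘ Fin.suc)) (g Fin.zero) (prodFinPS n (g ∘ Fin.suc))))
             (scale-scale (γ Fin.zero) (prodFinR n (γ ∘ Fin.suc)) (prodFinPS (suc n) g))))

  -- The partial derivative ∂/∂x_pq:  (D p q F)_e = (e_pq + 1) · F_{e + 1_pq}.

  D : Fin k → Fin k → PS → PS
  D p q F e = fromℕR (suc (e p q)) * F (incr e p q)

  D-cong : ∀ p q {F G} → F ≋ G → D p q F ≋ D p q G
  D-cong p q h e = *-cong refl (h _)

  D-⊕ : ∀ p q F G → D p q (F ⊕ G) ≋ (D p q F ⊕ D p q G)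
  D-⊕ p q F G e = distribˡ _ _ _

  D-scale : ∀ p q a F → D p q (scale a F) ≋ scale a (D p q F)
  D-scale p q a F e = trans (sym (*-assoc _ _ _)) (trans (*-cong (*-comm _ _) refl) (*-assoc _ _ _))

  D-const : ∀ p q x → D p q (constPS x) ≋ zeroPS
  D-const p q x e = trans (*-cong refl (reflexive (P.cong (λ b → if b then x else 0#) (isZeroM-incr e p q))))
                          (trans (zeroʳ _) (sym (zeroPS≈ e)))

  -- The derivative of a sum over the box below e+1_pq of a kernel H d (e+1_pq − d)
  -- splits according to which of the two arguments carries the new x_pq:
  -- the coefficient (e_pq + 1) = d_pq + (e+1_pq − d)_pq is split accordingly.
  -- This is the Leibniz rule, stated for general kernels so that it also
  -- applies to the locally finite sums sumX.
  D-convolution : (H : Mono k → Mono k → Carrier) → ExtΦ H → ∀ e p q →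
    fromℕR (suc (e p q)) * Σ_ (below (incr e p q)) (λ d → H d (incr e p q ∸ᴹ d))
    ≈ Σ_ (below e) (λ d → fromℕR (suc (d p q)) * H (incr d p q) (e ∸ᴹ d))
      + Σ_ (below e) (λ d → fromℕR (suc ((e ∸ᴹ d) p q)) * H d (incr (e ∸ᴹ d) p q))
  D-convolution H eH e p q = begin
    fromℕR (suc (e p q)) * Σ_ (below E) (λ d → H d (E ∸ᴹ d)) ≈⟨ sym (Σ-*ˡ (below E) _ _) ⟩
    Σ_ (below E) (λ d → fromℕR (suc (e p q)) * H d (E ∸ᴹ d)) ≈⟨ seesOnly-below E _ _ split ⟩
    Σ_ (below E) (λ d → left d + right d)                      ≈⟨ Σ-+ (below E) left right ⟩
    Σ_ (below E) left + Σ_ (below E) right                     ≈⟨ +-cong leftSum rightSum ⟩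
    _ ∎
    where
    E = incr e p q
    left right : Mono k → Carrier
    left  d = fromℕR (d p q) * H d (E ∸ᴹ d)
    right d = fromℕR ((E ∸ᴹ d) p q) * H d (E ∸ᴹ d)
    split : ∀ d → InBox E d → fromℕR (suc (e p q)) * H d (E ∸ᴹ d) ≈ left d + right d
    split d le = trans (*-cong (reflexive (P.cong fromℕR (P.trans (P.sym (incr-same e p q))
        (P.sym (NP.m+[n∸m]≡n (NP.≤-pred (le p q))))))) refl)
      (trans (*-cong (fromℕR-+ (d p q) _) refl) (distribʳ _ _ _))
    left-ext : ExtM left
    left-ext h = *-cong (reflexive (P.cong fromℕR (h p q))) (eH h (λ i j → P.cong (E i j ∸_) (h i j)))
    right-ext : ExtM right
    right-ext h = *-cong (reflexive (P.cong (λ z → fromℕR (E p q ∸ z)) (h p q))) (eH h (λ i j → P.cong (E i j ∸_) (h i j)))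
    leftSum : Σ_ (below E) left ≈ Σ_ (below e) (λ d → fromℕR (suc (d p q)) * H (incr d p q) (e ∸ᴹ d))
    leftSum = trans (below-shift e p q left left-ext (λ d z → trans (*-cong (reflexive (P.cong fromℕR z)) refl) (zeroˡ _)))
      (Σ-cong (below e) (λ d → *-cong (reflexive (P.cong fromℕR (incr-same d p q))) (eH (λ i j → P.refl) (incr-∸-incr e d p q))))
    rightSum : Σ_ (below E) right ≈ Σ_ (below e) (λ d → fromℕR (suc ((e ∸ᴹ d) p q)) * H d (incr (e ∸ᴹ d) p q))
    rightSum = trans
      (below-slice e p q right right-ext (λ d z → trans (*-cong (reflexive (P.cong fromℕR
         (P.trans (P.cong₂ _∸_ (incr-same e p q) z) (NP.n∸n≡0 (suc (e p q)))))) refl) (zeroˡ _)))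
      (seesOnly-below e _ _ (λ d le → let d≤e = incr-∸ e d p q (NP.≤-pred (le p q)) in
         *-cong (reflexive (P.cong fromℕR (P.trans (d≤e p q) (incr-same (e ∸ᴹ d) p q)))) (eH (λ i j → P.refl) d≤e)))

  D-⊗ : ∀ p q F G → ExtM F → ExtM G → D p q (F ⊗ G) ≋ ((D p q F ⊗ G) ⊕ (F ⊗ D p q G))
  D-⊗ p q F G eF eG e = trans (D-convolution (λ d x → F d * G x) (λ h h' → *-cong (eF h) (eG h')) e p q)
    (+-cong (Σ-cong (below e) (λ d → sym (*-assoc _ _ _)))
            (Σ-cong (below e) (λ d → trans (sym (*-assoc _ _ _)) (trans (*-cong (*-comm _ _) refl) (*-assoc _ _ _)))))

  -- Differentiating sumX Φ: terms with x_pq in the monomial x^d (only possible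
  -- above the diagonal) and terms differentiating the coefficient series Φ d.
  private
    D-sumX-coefficients : ∀ Φ p q e →
      Σ_ (below e) (λ d → fromℕR (suc ((e ∸ᴹ d) p q)) * upperPart Φ d (incr (e ∸ᴹ d) p q)) ≈ sumX (λ d → D p q (Φ d)) e
    D-sumX-coefficients Φ p q e = Σ-cong (below e) inner
      where
      inner : ∀ d → fromℕR (suc ((e ∸ᴹ d) p q)) * upperPart Φ d (incr (e ∸ᴹ d) p q) ≈ upperPart (λ d → D p q (Φ d)) d (e ∸ᴹ d)
      inner d with isUpper d
      ... | true  = refl
      ... | false = zeroʳ _

  D-sumX-above : ∀ p q → lt p q ≡ true → (Φ : Mono k → PS) → ExtΦ Φ →
    D p q (sumX Φ) ≋ (sumX (λ d → scale (fromℕR (suc (d p q))) (Φ (incr d p q))) ⊕ sumX (λ d → D p q (Φ d)))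
  D-sumX-above p q l Φ eΦ e =
    trans (D-convolution (upperPart Φ) (upperPart-ext Φ eΦ) e p q) (+-cong (Σ-cong (below e) monomial) (D-sumX-coefficients Φ p q e))
    where
    monomial : ∀ d → fromℕR (suc (d p q)) * upperPart Φ (incr d p q) (e ∸ᴹ d)
                   ≈ upperPart (λ d → scale (fromℕR (suc (d p q))) (Φ (incr d p q))) d (e ∸ᴹ d)
    monomial d rewrite isUpper-incr-above d p q l with isUpper d
    ... | true  = refl
    ... | false = zeroʳ _

  D-sumX-other : ∀ p q → lt p q ≡ false → (Φ : Mono k → PS) → ExtΦ Φ →
    D p q (sumX Φ) ≋ sumX (λ d → D p q (Φ d))
  D-sumX-other p q l Φ eΦ e = trans (D-convolution (upperPart Φ) (upperPart-ext Φ eΦ) e p q)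
    (trans (+-cong (Σ-zero (below e) _ (λ d → trans (*-cong refl (reflexive (P.cong (λ b → if b then Φ (incr d p q) (e ∸ᴹ d) else 0#)
                                                   (isUpper-incr-other d p q l)))) (zeroʳ _)))
                   (D-sumX-coefficients Φ p q e))
       (+-identityˡ _))

  D-prodFinPS : ∀ p q n (f g : Fin n → PS) (γ : Fin n → Carrier) → (∀ i → ExtM (f i)) → (∀ i → D p q (f i) ≋ scale (γ i) (g i)) →
    D p q (prodFinPS n f) ≋ sumFinPS n (λ i → scale (γ i) (prodFinPS n (λ j → if does (j ≟ i) then g j else f j)))
  D-prodFinPS p q zero    f g γ ef df = D-const p q 1#
  D-prodFinPS p q (suc n) f g γ ef df =
    ≋-trans (D-⊗ p q (f Fin.zero) (prodFinPS n (f ∘ Fin.suc)) (ef Fin.zero) (prodFinPS-ext n (f ∘ Fin.suc) (ef ∘ Fin.suc)))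
    (⊕-cong (≋-trans (⊗-congˡ (prodFinPS n (f ∘ Fin.suc)) (df Fin.zero)) (⊗-scaleˡ (γ Fin.zero) (g Fin.zero) (prodFinPS n (f ∘ Fin.suc))))
            (≋-trans (⊗-congʳ (f Fin.zero) (D-prodFinPS p q n (f ∘ Fin.suc) (g ∘ Fin.suc) (γ ∘ Fin.suc) (ef ∘ Fin.suc) (df ∘ Fin.suc)))
            (≋-trans (⊗-sumFinPS (f Fin.zero) n (λ i → scale (γ (Fin.suc i)) (others i)))
                     (sumFinPS-cong n (λ i → ⊗-scaleʳ (γ (Fin.suc i)) (f Fin.zero) (others i))))))
    where
    others : Fin n → PS
    others i = prodFinPS n (λ j → if does (j ≟ i) then g (Fin.suc j) else f (Fin.suc j))

  D-prodFinPS-eigen : ∀ p q n (f : Fin n → PS) (γ : Fin n → Carrier) → (∀ i → ExtM (f i)) → (∀ i → D p q (f i) ≋ scale (γ i) (f i)) →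
    D p q (prodFinPS n f) ≋ scale (sumFinR n γ) (prodFinPS n f)
  D-prodFinPS-eigen p q zero    f γ ef df = ≋-trans (D-const p q 1#) (≋-sym (scale-0# onePS))
  D-prodFinPS-eigen p q (suc n) f γ ef df =
    ≋-trans (D-⊗ p q (f Fin.zero) (prodFinPS n (f ∘ Fin.suc)) (ef Fin.zero) (prodFinPS-ext n (f ∘ Fin.suc) (ef ∘ Fin.suc)))
    (≋-trans (⊕-cong (≋-trans (⊗-congˡ (prodFinPS n (f ∘ Fin.suc)) (df Fin.zero)) (⊗-scaleˡ (γ Fin.zero) (f Fin.zero) (prodFinPS n (f ∘ Fin.suc))))
                     (≋-trans (⊗-congʳ (f Fin.zero) (D-prodFinPS-eigen p q n (f ∘ Fin.suc) (γ ∘ Fin.suc) (ef ∘ Fin.suc) (df ∘ Fin.suc)))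
                              (⊗-scaleʳ (sumFinR n (γ ∘ Fin.suc)) (f Fin.zero) (prodFinPS n (f ∘ Fin.suc)))))
             (scale-⊕ (γ Fin.zero) (sumFinR n (γ ∘ Fin.suc)) (prodFinPS (suc n) f)))

  δ : Fin k → Fin k → Fin k → Fin k → Carrier
  δ p q a b = if both≟ p a q b then 1# else 0#

  δ-away : ∀ p q a b → ¬ (p ≡ a × q ≡ b) → δ p q a b ≈ 0#
  δ-away p q a b ne = reflexive (P.cong (λ z → if z then 1# else 0#) (both≟-away p a q b ne))

  δ-here : ∀ p q → δ p q p q ≈ 1#
  δ-here p q = reflexive (P.cong (λ z → if z then 1# else 0#) (both≟-here p q))

  incr-unit⇒zero : ∀ e p q → isUnitM p q (incr e p q) ≡ true → ∀ i j → e i j ≡ 0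
  incr-unit⇒zero e p q unit i j with position p q i j
  ... | here P.refl P.refl = NP.suc-injective (P.trans (P.sym (incr-same e p q))
                               (P.trans (entry p q) (P.cong (λ z → if z then 1 else 0) (both≟-here p q))))
    where entry = isUnitM-entry p q (incr e p q) unit
  ... | away ne = P.trans (P.sym (incr-other e p q i j ne))
                    (P.trans (isUnitM-entry p q (incr e p q) unit i j) (P.cong (λ z → if z then 1 else 0) (both≟-away i p j q ne)))

  -- var a b (incr e p q) is 1 exactly when (a,b) = (p,q) and e = 0.
  D-var : ∀ p q a b → D p q (var a b) ≋ constPS (δ p q a b)
  D-var p q a b e with isUnitM a b (incr e p q) in unit
  ... | true  = hit (position a b p q)
    where
    entry : ∀ i j → incr e p q i j ≡ (if both≟ i a j b then 1 else 0)
    entry = isUnitM-entry a b (incr e p q) unit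
    hit : Position a b p q → fromℕR (suc (e p q)) * 1# ≈ constPS (δ p q a b) e
    hit (away ne) = ⊥-elim (NP.0≢1+n (P.trans (P.sym (P.trans (entry p q) (P.cong (λ z → if z then 1 else 0) (both≟-away p a q b ne))))
                                              (incr-same e p q)))
    hit (here P.refl P.refl) rewrite isZeroM-intro e (incr-unit⇒zero e p q unit) | both≟-here p q | incr-unit⇒zero e p q unit p q
      = trans (*-identityʳ _) (+-identityʳ _)
  ... | false = trans (zeroʳ _) (sym miss)
    where
    miss : constPS (δ p q a b) e ≈ 0#
    miss with isZeroM e in zero-e
    ... | false = refl
    ... | true with position a b p q
    ...   | away ne = δ-away p q a b ne
    ...   | here P.refl P.refl = ⊥-elim (true≢false (P.trans (P.sym (isUnitM-intro p q (incr e p q)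
             (P.trans (incr-same e p q) (P.cong suc (isZeroM-sound e zero-e p q)))
             (λ i j ne → P.trans (incr-other e p q i j ne) (isZeroM-sound e zero-e i j)))) unit))

  σ : Fin k → Fin k → Fin k → Fin k → Carrier
  σ p q i j = if lt i j then δ p q i j else δ p q j i

  D-symVar : ∀ p q i j → D p q (symVar i j) ≋ constPS (σ p q i j)
  D-symVar p q i j with lt i j
  ... | true  = D-var p q i j
  ... | false = D-var p q j i

  D-sumFinPS-const : ∀ p q n (f : Fin n → PS) (g : Fin n → Carrier) → (∀ j → D p q (f j) ≋ constPS (g j)) →
    D p q (sumFinPS n f) ≋ constPS (sumFinR n g)
  D-sumFinPS-const p q zero    f g h = D-const p q 0#
  D-sumFinPS-const p q (suc n) f g h =
    ≋-trans (D-⊕ p q (f Fin.zero) (sumFinPS n (f ∘ Fin.suc)))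
    (≋-trans (⊕-cong (h Fin.zero) (D-sumFinPS-const p q n (f ∘ Fin.suc) (g ∘ Fin.suc) (h ∘ Fin.suc)))
             (const-+ (g Fin.zero) (sumFinR n (g ∘ Fin.suc))))

  wTerm : (Fin k → Carrier) → Fin k → Fin k → PS
  wTerm r i j = if does (i ≟ j) then zeroPS else scale (r j) (symVar i j)

  w : (Fin k → Carrier) → Fin k → PS
  w r i = sumFinPS k (wTerm r i)

  w-ext : ∀ r i → ExtM (w r i)
  w-ext r i = sumFinPS-ext k _ term-ext
    where
    term-ext : ∀ j → ExtM (wTerm r i j)
    term-ext j with does (i ≟ j)
    ... | true  = zeroPS-ext
    ... | false = scale-ext (r j) (symVar-ext i j)

  -- ∂w_i/∂x_pq: for p < q it is r_q if i = p, r_p if i = q and 0 otherwise;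
  -- it vanishes if p ≥ q, since x_pq does not occur in any w_i then.
  ∂w : (Fin k → Carrier) → Fin k → Fin k → Fin k → Carrier
  ∂w r p q i = if lt p q then (if does (i ≟ p) then r q else (if does (i ≟ q) then r p else 0#)) else 0#

  private
    wCoeff : (Fin k → Carrier) → Fin k → Fin k → Fin k → Fin k → Carrier
    wCoeff r p q i j = if does (i ≟ j) then 0# else r j * σ p q i j

    D-wTerm : ∀ r p q i j → D p q (wTerm r i j) ≋ constPS (wCoeff r p q i j)
    D-wTerm r p q i j with does (i ≟ j)
    ... | true  = D-const p q 0#
    ... | false = ≋-trans (D-scale p q (r j) (symVar i j))
                  (≋-trans (scale-cong refl (D-symVar p q i j)) (scale-const (r j) (σ p q i j)))

    wCoeff-zero : ∀ r p q i j → (i ≢ j → σ p q i j ≈ 0#) → wCoeff r p q i j ≈ 0#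
    wCoeff-zero r p q i j h with i ≟ j
    ... | yes _ = refl
    ... | no ne = trans (*-cong refl (h ne)) (zeroʳ _)

    wCoeff-hit : ∀ r p q i j → i ≢ j → σ p q i j ≈ 1# → wCoeff r p q i j ≈ r j
    wCoeff-hit r p q i j ne h rewrite dec-false (i ≟ j) ne = trans (*-cong refl h) (*-identityʳ _)

    σ-off : ∀ p q i j → ¬ (i ≡ p × j ≡ q) → ¬ (i ≡ q × j ≡ p) → σ p q i j ≈ 0#
    σ-off p q i j n₁ n₂ with lt i j
    ... | true  = δ-away p q i j (λ { (P.refl , P.refl) → n₁ (P.refl , P.refl) })
    ... | false = δ-away p q j i (λ { (P.refl , P.refl) → n₂ (P.refl , P.refl) })

    σ-pq : ∀ p q → lt p q ≡ true → σ p q p q ≈ 1#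
    σ-pq p q l = trans (reflexive (P.cong (λ b → if b then δ p q p q else δ p q q p) l)) (δ-here p q)

    σ-qp : ∀ p q → lt p q ≡ true → σ p q q p ≈ 1#
    σ-qp p q l = trans (reflexive (P.cong (λ b → if b then δ p q q p else δ p q p q) (lt-asym {i = p} {j = q} l))) (δ-here p q)

    σ-below : ∀ p q i j → lt p q ≡ false → i ≢ j → σ p q i j ≈ 0#
    σ-below p q i j l ne with lt i j in l'
    ... | true  = δ-away p q i j (λ { (P.refl , P.refl) → true≢false (P.trans (P.sym l') l) })
    ... | false = δ-away p q j i (λ { (P.refl , P.refl) → ne (lt-tri {i = i} {j = j} l' l) })

    Σ-wCoeff : ∀ r p q i → sumFinR k (wCoeff r p q i) ≈ ∂w r p q i
    Σ-wCoeff r p q i with lt p q in l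
    Σ-wCoeff r p q i | false = sumFinR-zero k _ (λ j → wCoeff-zero r p q i j (σ-below p q i j l))
    Σ-wCoeff r p q i | true with i ≟ p
    ... | yes P.refl = trans
      (sumFinR-delta k _ q (λ j jq → wCoeff-zero r p q p j (λ _ → σ-off p q p j (jq ∘ proj₂) (p≢q ∘ proj₁))))
      (wCoeff-hit r p q p q p≢q (σ-pq p q l))
      where p≢q = lt⇒≢ {i = p} {j = q} l
    ... | no ip with i ≟ q
    ...   | yes P.refl = trans
      (sumFinR-delta k _ p (λ j jp → wCoeff-zero r p q q j (λ _ → σ-off p q q j (ip ∘ proj₁) (jp ∘ proj₂))))
      (wCoeff-hit r p q q p ip (σ-qp p q l))
    ...   | no iq = sumFinR-zero k _ (λ j → wCoeff-zero r p q i j (λ _ → σ-off p q i j (ip ∘ proj₁) (iq ∘ proj₁)))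

  D-w : ∀ r p q i → D p q (w r i) ≋ constPS (∂w r p q i)
  D-w r p q i = ≋-trans (D-sumFinPS-const p q k (wTerm r i) (wCoeff r p q i) (D-wTerm r p q i)) (constPS-cong (Σ-wCoeff r p q i))

  ∂w-p : ∀ (r : Fin k → Carrier) p q → lt p q ≡ true → ∂w r p q p ≈ r q
  ∂w-p r p q l rewrite l | dec-true (p ≟ p) P.refl = refl

  ∂w-q : ∀ (r : Fin k → Carrier) p q → lt p q ≡ true → ∂w r p q q ≈ r p
  ∂w-q r p q l rewrite l | dec-false (q ≟ p) (lt⇒≢ {i = p} {j = q} l ∘ P.sym) | dec-true (q ≟ q) P.refl = refl

  ∂w-off : ∀ (r : Fin k → Carrier) p q i → i ≢ p → i ≢ q → ∂w r p q i ≈ 0#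
  ∂w-off r p q i ip iq rewrite dec-false (i ≟ p) ip | dec-false (i ≟ q) iq with lt p q
  ... | true  = refl
  ... | false = refl

  ∂w-below : ∀ (r : Fin k → Carrier) p q i → lt p q ≡ false → ∂w r p q i ≈ 0#
  ∂w-below r p q i l rewrite l = refl

  rising-cong : ∀ {u u'} → u ≈ u' → ∀ m → rising u m ≈ rising u' m
  rising-cong h zero    = refl
  rising-cong h (suc m) = *-cong (rising-cong h m) (+-cong h refl)

  rising-suc : ∀ u m → rising u (suc m) ≈ u * rising (u + 1#) m
  rising-suc u zero    = trans (*-identityˡ _) (trans (+-identityʳ _) (sym (*-identityʳ _)))
  rising-suc u (suc m) = begin
    rising u (suc m) * (u + (1# + fromℕR m))          ≈⟨ *-cong (rising-suc u m) (sym (+-assoc _ _ _)) ⟩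
    (u * rising (u + 1#) m) * ((u + 1#) + fromℕR m)   ≈⟨ *-assoc _ _ _ ⟩
    u * rising (u + 1#) (suc m)                       ∎

  -- Recurrence of the Charlier polynomials:
  --   C_{n+1}(a,r) = r C_n(a,r) + a C_n(a+1,r),
  -- from Pascal's rule for the binomial coefficients and (a)_{m+1} = a (a+1)_m.
  charlier-suc : ∀ n a r → charlier (suc n) a r ≈ r * charlier n a r + a * charlier n (a + 1#) r
  charlier-suc n a r = begin
    Σ_ (upTo (suc (suc n))) (term a (suc n))                          ≈⟨ Σ-upTo-first (suc n) _ ⟩
    term a (suc n) 0 + Σ_ (upTo (suc n)) (term a (suc n) ∘ suc)        ≈⟨ +-cong refl (Σ-cong (upTo (suc n)) pascal) ⟩
    term a (suc n) 0 + Σ_ (upTo (suc n)) (λ m → A m + B m)             ≈⟨ +-cong refl (Σ-+ (upTo (suc n)) A B) ⟩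
    term a (suc n) 0 + (Σ_ (upTo (suc n)) A + Σ_ (upTo (suc n)) B)     ≈⟨ +-cong first (+-cong sumA sumB) ⟩
    r * term a n 0 + (a * charlier n (a + 1#) r + r * Σ_ (upTo n) (term a n ∘ suc))
      ≈⟨ Sol.solve 4 (λ x y z t → x Sol.:* y Sol.:+ (z Sol.:+ x Sol.:* t) Sol.:= x Sol.:* (y Sol.:+ t) Sol.:+ z) refl
           r (term a n 0) (a * charlier n (a + 1#) r) (Σ_ (upTo n) (term a n ∘ suc)) ⟩
    r * (term a n 0 + Σ_ (upTo n) (term a n ∘ suc)) + a * charlier n (a + 1#) r
      ≈⟨ +-cong (*-cong refl (sym (Σ-upTo-first n _))) refl ⟩
    r * charlier n a r + a * charlier n (a + 1#) r ∎
    where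
    term : Carrier → ℕ → ℕ → Carrier
    term x n m = fromℕR (n C m) * rising x m * powR r (n ∸ m)
    A B : ℕ → Carrier
    A m = fromℕR (n C m) * rising a (suc m) * powR r (n ∸ m)
    B m = fromℕR (n C suc m) * rising a (suc m) * powR r (n ∸ m)
    pascal : ∀ m → term a (suc n) (suc m) ≈ A m + B m
    pascal m = trans (*-cong (*-cong (trans (reflexive (P.cong fromℕR (P.sym (nCk+nC[k+1]≡[n+1]C[k+1] n m))))
                                            (fromℕR-+ (n C m) (n C suc m))) refl) refl)
                     (trans (*-cong (distribʳ _ _ _) refl) (distribʳ _ _ _))
    first : term a (suc n) 0 ≈ r * term a n 0
    first = Sol.solve 3 (λ u x y → u Sol.:* (y Sol.:* x) Sol.:= x Sol.:* (u Sol.:* y)) refl (fromℕR 1 * 1#) r (powR r n)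
    sumA : Σ_ (upTo (suc n)) A ≈ a * charlier n (a + 1#) r
    sumA = trans (Σ-cong (upTo (suc n)) (λ m → trans (*-cong (*-cong refl (rising-suc a m)) refl)
          (Sol.solve 4 (λ b x ρ y → b Sol.:* (x Sol.:* ρ) Sol.:* y Sol.:= x Sol.:* (b Sol.:* ρ Sol.:* y)) refl
            (fromℕR (n C m)) a (rising (a + 1#) m) (powR r (n ∸ m)))))
         (Σ-*ˡ (upTo (suc n)) a _)
    -- the last summand of B vanishes since n C (n+1) = 0, and r^(n-m) = r · r^(n-(m+1)) for m < n
    sumB : Σ_ (upTo (suc n)) B ≈ r * Σ_ (upTo n) (term a n ∘ suc)
    sumB = begin
      Σ_ (upTo (suc n)) B  ≈⟨ Σ-upTo-last n B ⟩
      Σ_ (upTo n) B + B n  ≈⟨ +-cong refl (trans (*-cong (*-cong (reflexive (P.cong fromℕR (k>n⇒nCk≡0 (NP.n<1+n n)))) refl) refl)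
                                             (trans (*-cong (zeroˡ _) refl) (zeroˡ _))) ⟩
      Σ_ (upTo n) B + 0#   ≈⟨ +-identityʳ _ ⟩
      Σ_ (upTo n) B        ≈⟨ seesOnly-upTo n _ _ (λ m m<n → trans (*-cong refl (reflexive (P.cong (powR r) (NP.+-∸-assoc 1 m<n))))
            (Sol.solve 4 (λ b ρ y x → b Sol.:* ρ Sol.:* (y Sol.:* x) Sol.:= x Sol.:* (b Sol.:* ρ Sol.:* y)) refl
               (fromℕR (n C suc m)) (rising a (suc m)) (powR r (n ∸ suc m)) r)) ⟩
      Σ_ (upTo n) (λ m → r * term a n (suc m)) ≈⟨ Σ-*ˡ (upTo n) r _ ⟩
      r * Σ_ (upTo n) (term a n ∘ suc) ∎

  below-zeroM : ∀ ψ → ExtM ψ → Σ_ (below zeroM) ψ ≈ ψ zeroM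
  below-zeroM ψ eψ = below-delta zeroM zeroM (λ i j → z≤n) ψ eψ
    (λ d le nd → ⊥-elim (nd (λ i j → NP.n≤0⇒n≡0 (NP.≤-pred (le i j)))))

  constPS-at0 : ∀ x → constPS x zeroM ≈ x
  constPS-at0 x = reflexive (P.cong (λ b → if b then x else 0#) (isZeroM-intro zeroM (λ i j → P.refl)))

  ⊗-at0 : ∀ F G → ExtM F → ExtM G → (F ⊗ G) zeroM ≈ F zeroM * G zeroM
  ⊗-at0 F G eF eG = below-zeroM (λ d → F d * G (zeroM ∸ᴹ d)) (λ h → *-cong (eF h) (eG (λ i j → P.cong (0 ∸_) (h i j))))

  prodFinPS-at0 : ∀ n (f : Fin n → PS) → (∀ i → ExtM (f i)) → prodFinPS n f zeroM ≈ prodFinR n (λ i → f i zeroM)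
  prodFinPS-at0 zero    f ef = constPS-at0 1#
  prodFinPS-at0 (suc n) f ef = trans (⊗-at0 _ _ (ef Fin.zero) (prodFinPS-ext n (f ∘ Fin.suc) (ef ∘ Fin.suc)))
    (*-cong refl (prodFinPS-at0 n (f ∘ Fin.suc) (ef ∘ Fin.suc)))

  sumX-at0 : ∀ Φ → ExtΦ Φ → sumX Φ zeroM ≈ Φ zeroM zeroM
  sumX-at0 Φ eΦ = trans (below-zeroM _ (λ h → upperPart-ext Φ eΦ h (λ i j → P.cong (0 ∸_) (h i j))))
    (reflexive (P.cong (λ b → if b then Φ zeroM zeroM else 0#) (isUpper-intro zeroM (λ i j _ → P.refl))))

  module _ (inv : ℕ → Carrier) (invH : ∀ n → fromℕR (suc n) * inv (suc n) ≈ 1#) where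
    open Series.WithInverses R k inv

    inv-right : ∀ n → .{{NonZero n}} → fromℕR n * inv n ≈ 1#
    inv-right (suc n) = invH n

    inv-one : inv 1 ≈ 1#
    inv-one = trans (sym (*-identityˡ _)) (trans (*-cong (sym (+-identityʳ _)) refl) (invH 0))

    inv-fact-suc : ∀ m → inv (suc m !) * fromℕR (suc m) ≈ inv (m !)
    inv-fact-suc m = begin
      inv (suc m !) * fromℕR (suc m)                                      ≈⟨ sym (*-identityˡ _) ⟩
      1# * (inv (suc m !) * fromℕR (suc m))                               ≈⟨ *-cong (sym (trans (*-comm _ _) (inv-right (m !) {{m !≢0}}))) refl ⟩
      (inv (m !) * fromℕR (m !)) * (inv (suc m !) * fromℕR (suc m))       ≈⟨ *-assoc _ _ _ ⟩
      inv (m !) * (fromℕR (m !) * (inv (suc m !) * fromℕR (suc m)))       ≈⟨ *-cong refl (trans (*-cong refl (*-comm _ _)) (sym (*-assoc _ _ _))) ⟩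
      inv (m !) * ((fromℕR (m !) * fromℕR (suc m)) * inv (suc m !))       ≈⟨ *-cong refl (*-cong (trans (*-comm _ _) (sym (fromℕR-* (suc m) (m !)))) refl) ⟩
      inv (m !) * (fromℕR (suc m !) * inv (suc m !))                      ≈⟨ *-cong refl (inv-right (suc m !) {{suc m !≢0}}) ⟩
      inv (m !) * 1#                                                      ≈⟨ *-identityʳ _ ⟩
      inv (m !)                                                           ∎

    cancel : ∀ m {A B} → fromℕR (suc m) * A ≈ fromℕR (suc m) * B → A ≈ B
    cancel m {A} {B} h = begin
      A                                   ≈⟨ sym (*-identityˡ _) ⟩
      1# * A                              ≈⟨ *-cong (sym inv*m) refl ⟩
      (inv (suc m) * fromℕR (suc m)) * A  ≈⟨ *-assoc _ _ _ ⟩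
      inv (suc m) * (fromℕR (suc m) * A)  ≈⟨ *-cong refl h ⟩
      inv (suc m) * (fromℕR (suc m) * B)  ≈⟨ sym (*-assoc _ _ _) ⟩
      (inv (suc m) * fromℕR (suc m)) * B  ≈⟨ *-cong inv*m refl ⟩
      1# * B                              ≈⟨ *-identityˡ _ ⟩
      B                                   ∎
      where
      inv*m : inv (suc m) * fromℕR (suc m) ≈ 1#
      inv*m = trans (*-comm _ _) (invH m)

    D-pow : ∀ p q w γ → ExtM w → D p q w ≋ constPS γ → ∀ m → D p q (powPS w (suc m)) ≋ scale (fromℕR (suc m) * γ) (powPS w m)
    D-pow p q w γ ew dw zero = ≋-trans (D-⊗ p q onePS w onePS-ext ew)
      (≋-trans (⊕-cong (≋-trans (⊗-congˡ w (D-const p q 1#)) (⊗-zeroˡ w)) (≋-trans (⊗-congʳ onePS dw) (⊗-constʳ onePS onePS-ext γ)))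
      (λ e → trans (+-cong (zeroPS≈ e) refl) (trans (+-identityˡ _) (*-cong (sym (trans (*-cong (+-identityʳ _) refl) (*-identityˡ _))) refl))))
    D-pow p q w γ ew dw (suc m) = ≋-trans (D-⊗ p q (powPS w (suc m)) w (powPS-ext w ew (suc m)) ew)
      (≋-trans (⊕-cong (≋-trans (⊗-congˡ w (D-pow p q w γ ew dw m)) (⊗-scaleˡ _ (powPS w m) w))
                       (≋-trans (⊗-congʳ (powPS w (suc m)) dw) (⊗-constʳ (powPS w (suc m)) (powPS-ext w ew (suc m)) γ)))
      (λ e → trans (sym (distribʳ _ _ _)) (*-cong (trans (+-cong refl (sym (*-identityˡ γ)))
               (trans (sym (distribʳ _ _ _)) (*-cong (+-comm _ _) refl))) refl)))

    -- The exponential generating series Σ_m c_m w^m/m! of a sequence c, for w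
    -- without constant term (so only m ≤ deg e contributes to the coefficient
    -- of x^e). binomPS and expPS are instances.
    egf : (ℕ → Carrier) → PS → PS
    egf c w e = Σ_ (upTo (suc (deg e))) (λ m → c m * inv (m !) * powPS w m e)

    egf-ext : ∀ c w → ExtM w → ExtM (egf c w)
    egf-ext c w ew {e} {e'} h = trans (Σ-cong (upTo (suc (deg e))) (λ m → *-cong refl (powPS-ext w ew m h)))
      (reflexive (P.cong (λ n → Σ_ (upTo (suc n)) (λ m → c m * inv (m !) * powPS w m e')) (deg-cong h)))

    egf-cong : ∀ {c c'} w → (∀ m → c m ≈ c' m) → egf c w ≋ egf c' w
    egf-cong w h e = Σ-cong (upTo (suc (deg e))) (λ m → *-cong (*-cong (h m) refl) refl)

    egf-scale : ∀ x c w → egf (λ m → x * c m) w ≋ scale x (egf c w)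
    egf-scale x c w e = trans (Σ-cong (upTo (suc (deg e))) (λ m → trans (*-cong (*-assoc _ _ _) refl) (*-assoc _ _ _)))
                              (Σ-*ˡ (upTo (suc (deg e))) x _)

    expPS≋egf : ∀ w → expPS w ≋ egf (λ _ → 1#) w
    expPS≋egf w e = Σ-cong (upTo (suc (deg e))) (λ m → *-cong (sym (*-identityˡ _)) refl)

    expPS-ext : ∀ w → ExtM w → ExtM (expPS w)
    expPS-ext w ew {e} {e'} h = trans (expPS≋egf w e) (trans (egf-ext _ w ew h) (sym (expPS≋egf w e')))

    D-egf : ∀ p q c w γ → ExtM w → D p q w ≋ constPS γ → D p q (egf c w) ≋ scale γ (egf (c ∘ suc) w)
    D-egf p q c w γ ew dw e = begin
      fromℕR (suc (e p q)) * Σ_ (upTo (suc (deg E))) (λ m → c m * inv (m !) * powPS w m E)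
        ≡⟨ P.cong (λ n → fromℕR (suc (e p q)) * Σ_ (upTo (suc n)) (λ m → c m * inv (m !) * powPS w m E)) (deg-incr e p q) ⟩
      fromℕR (suc (e p q)) * Σ_ (upTo (suc (suc (deg e)))) (λ m → c m * inv (m !) * powPS w m E)
        ≈⟨ sym (Σ-*ˡ (upTo (suc (suc (deg e)))) _ _) ⟩
      Σ_ (upTo (suc (suc (deg e)))) (λ m → fromℕR (suc (e p q)) * (c m * inv (m !) * powPS w m E))
        ≈⟨ Σ-cong (upTo (suc (suc (deg e)))) (λ m → trans (sym (*-assoc _ _ _)) (trans (*-cong (*-comm _ _) refl) (*-assoc _ _ _))) ⟩
      Σ_ (upTo (suc (suc (deg e)))) (λ m → c m * inv (m !) * D p q (powPS w m) e)
        ≈⟨ Σ-upTo-first (suc (deg e)) _ ⟩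
      c 0 * inv 1 * D p q onePS e + Σ_ (upTo (suc (deg e))) (λ m → c (suc m) * inv (suc m !) * D p q (powPS w (suc m)) e)
        ≈⟨ +-cong (trans (*-cong refl (trans (D-const p q 1# e) (zeroPS≈ e))) (zeroʳ _))
                  (Σ-cong (upTo (suc (deg e))) (λ m → trans (*-cong refl (D-pow p q w γ ew dw m e)) (term m))) ⟩
      0# + Σ_ (upTo (suc (deg e))) (λ m → γ * (c (suc m) * inv (m !) * powPS w m e))
        ≈⟨ +-identityˡ _ ⟩
      Σ_ (upTo (suc (deg e))) (λ m → γ * (c (suc m) * inv (m !) * powPS w m e))
        ≈⟨ Σ-*ˡ (upTo (suc (deg e))) γ _ ⟩
      γ * egf (c ∘ suc) w e ∎
      where
      E = incr e p q
      term : ∀ m → c (suc m) * inv (suc m !) * ((fromℕR (suc m) * γ) * powPS w m e) ≈ γ * (c (suc m) * inv (m !) * powPS w m e)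
      term m = begin
        c (suc m) * inv (suc m !) * ((fromℕR (suc m) * γ) * powPS w m e)
          ≈⟨ Sol.solve 5 (λ x y z g t → x Sol.:* y Sol.:* ((z Sol.:* g) Sol.:* t) Sol.:= g Sol.:* (x Sol.:* (y Sol.:* z) Sol.:* t)) refl
               (c (suc m)) (inv (suc m !)) (fromℕR (suc m)) γ (powPS w m e) ⟩
        γ * (c (suc m) * (inv (suc m !) * fromℕR (suc m)) * powPS w m e)
          ≈⟨ *-cong refl (*-cong (*-cong refl (inv-fact-suc m)) refl) ⟩
        γ * (c (suc m) * inv (m !) * powPS w m e) ∎

    D-exp : ∀ p q w γ → ExtM w → D p q w ≋ constPS γ → D p q (expPS w) ≋ scale γ (expPS w)
    D-exp p q w γ ew dw = ≋-trans (D-cong p q (expPS≋egf w))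
      (≋-trans (D-egf p q (λ _ → 1#) w γ ew dw) (scale-cong refl (≋-sym (expPS≋egf w))))

    D-binom : ∀ p q a w γ → ExtM w → D p q w ≋ constPS γ → D p q (binomPS a w) ≋ scale (a * γ) (binomPS (a + 1#) w)
    D-binom p q a w γ ew dw = ≋-trans (D-egf p q (rising a) w γ ew dw)
      (≋-trans (scale-cong refl (≋-trans (egf-cong w (rising-suc a)) (egf-scale a (rising (a + 1#)) w)))
      (≋-trans (scale-scale γ a _) (scale-cong (*-comm γ a) ≋-refl)))

    egf-at0 : ∀ c w → egf c w zeroM ≈ c 0
    egf-at0 c w = trans (reflexive (P.cong (λ n → Σ_ (upTo (suc n)) (λ m → c m * inv (m !) * powPS w m zeroM)) (deg-zeroM)))
      (trans (+-identityʳ _) (trans (*-cong (*-cong refl inv-one) (constPS-at0 1#)) (trans (*-identityʳ _) (*-identityʳ _))))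

    invMatFact-cong : ∀ {d d'} → d ≗ᴹ d' → invMatFact d ≈ invMatFact d'
    invMatFact-cong h = prodFinR-cong k (λ i → prodFinR-cong k (λ j →
      reflexive (P.cong (λ z → if lt i j then inv (z !) else 1#) (h i j))))

    invMatFact-at0 : invMatFact zeroM ≈ 1#
    invMatFact-at0 = prodFinR-one k _ (λ i → prodFinR-one k _ (λ j → entry i j))
      where
      entry : ∀ i j → (if lt i j then inv (0 !) else 1#) ≈ 1#
      entry i j with lt i j
      ... | true  = inv-one
      ... | false = refl

    invMatFact-incr : ∀ d p q → lt p q ≡ true → fromℕR (suc (d p q)) * invMatFact (incr d p q) ≈ invMatFact d
    invMatFact-incr d p q l = prodFinR-absorb k _ _ p _
      (λ i ne → prodFinR-cong k (λ j → reflexive (P.cong (λ z → if lt i j then inv (z !) else 1#)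
         (incr-other d p q i j (ne ∘ proj₁)))))
      (prodFinR-absorb k _ _ q _ (λ j ne → reflexive (P.cong (λ z → if lt p j then inv (z !) else 1#)
         (incr-other d p q p j (ne ∘ proj₂)))) entry)
      where
      entry : fromℕR (suc (d p q)) * (if lt p q then inv (incr d p q p q !) else 1#) ≈ (if lt p q then inv (d p q !) else 1#)
      entry rewrite l | incr-same d p q = trans (*-comm _ _) (inv-fact-suc (d p q))

    Params : Set c
    Params = Fin k → Carrier

    shift : Params → Fin k → Params
    shift a i = updateAt a i (_+ 1#)

    shift-same : ∀ a i → shift a i i ≡ a i + 1#
    shift-same a i = updateAt-updates i a

    shift-other : ∀ a i j → j ≢ i → shift a i j ≡ a j
    shift-other a i j ne = updateAt-minimal j i a ne

    binomPS-cong : ∀ {x y} v → x ≈ y → binomPS x v ≋ binomPS y v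
    binomPS-cong v h = egf-cong v (rising-cong h)

    binomPS-ext : ∀ x v → ExtM v → ExtM (binomPS x v)
    binomPS-ext x v = egf-ext (rising x) v

    binomPS-at0 : ∀ x v → binomPS x v zeroM ≈ 1#
    binomPS-at0 x v = egf-at0 (rising x) v

    binomFactor : Carrier → ℕ → PS → PS
    binomFactor x n v = constPS (rising x n) ⊗ binomPS (fromℕR n + x) v

    binomFactor-ext : ∀ x n v → ExtM v → ExtM (binomFactor x n v)
    binomFactor-ext x n v ev = ⊗-ext (constPS (rising x n)) (binomPS-ext (fromℕR n + x) v ev)

    binomFactor-scale : ∀ x n v → ExtM v → binomFactor x n v ≋ scale (rising x n) (binomPS (fromℕR n + x) v)
    binomFactor-scale x n v ev = ⊗-constˡ _ (binomPS-ext (fromℕR n + x) v ev) (rising x n)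

    binomFactor-at0 : ∀ x v → ExtM v → binomFactor x 0 v zeroM ≈ 1#
    binomFactor-at0 x v ev = trans (binomFactor-scale x 0 v ev zeroM) (trans (*-identityˡ _) (binomPS-at0 _ v))

    binomFactor-suc : ∀ x n v → ExtM v → binomFactor x (suc n) v ≋ scale x (binomFactor (x + 1#) n v)
    binomFactor-suc x n v ev = ≋-trans (binomFactor-scale x (suc n) v ev)
      (≋-trans (scale-cong (rising-suc x n) (binomPS-cong v (Sol.solve 3 (λ o m y → (o Sol.:+ m) Sol.:+ y Sol.:= m Sol.:+ (y Sol.:+ o)) refl 1# (fromℕR n) x)))
      (≋-trans (≋-sym (scale-scale x _ _)) (scale-cong refl (≋-sym (binomFactor-scale (x + 1#) n v ev)))))

    D-binomFactor : ∀ p q x n v γ → ExtM v → D p q v ≋ constPS γ → D p q (binomFactor x n v) ≋ scale (x * γ) (binomFactor (x + 1#) n v)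
    D-binomFactor p q x n v γ ev dv = ≋-trans (D-⊗ p q (constPS ρ) (binomPS c₀ v) (constPS-ext ρ) (binomPS-ext c₀ v ev))
      (≋-trans (⊕-cong (≋-trans (⊗-congˡ (binomPS c₀ v) (D-const p q ρ)) (⊗-zeroˡ (binomPS c₀ v)))
                       (≋-trans (⊗-congʳ (constPS ρ) (D-binom p q c₀ v γ ev dv))
                       (≋-trans (⊗-scaleʳ (c₀ * γ) (constPS ρ) (binomPS (c₀ + 1#) v))
                                (scale-cong refl (⊗-constˡ _ (binomPS-ext (c₀ + 1#) v ev) ρ)))))
      (≋-trans (⊕-identityˡ _)
      (λ e → begin
        (c₀ * γ) * (ρ * binomPS (c₀ + 1#) v e)
          ≈⟨ Sol.solve 4 (λ a b x y → (a Sol.:* b) Sol.:* (x Sol.:* y) Sol.:= b Sol.:* ((a Sol.:* x) Sol.:* y)) refl c₀ γ ρ _ ⟩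
        γ * ((c₀ * ρ) * binomPS (c₀ + 1#) v e)
          ≈⟨ *-cong refl (*-cong c₀ρ (binomPS-cong v (+-assoc _ _ _) e)) ⟩
        γ * ((x * ρ′) * binomPS (fromℕR n + (x + 1#)) v e)
          ≈⟨ Sol.solve 4 (λ a b x y → b Sol.:* ((a Sol.:* x) Sol.:* y) Sol.:= (a Sol.:* b) Sol.:* (x Sol.:* y)) refl x γ ρ′ _ ⟩
        (x * γ) * (ρ′ * binomPS (fromℕR n + (x + 1#)) v e)
          ≈⟨ *-cong refl (sym (binomFactor-scale (x + 1#) n v ev e)) ⟩
        (x * γ) * binomFactor (x + 1#) n v e ∎)))
      where
      c₀ = fromℕR n + x
      ρ  = rising x n
      ρ′ = rising (x + 1#) n
      -- (n + x)(x)_n = (x)_{n+1} = x (x+1)_n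
      c₀ρ : c₀ * ρ ≈ x * ρ′
      c₀ρ = trans (*-comm _ _) (trans (*-cong refl (+-comm _ _)) (rising-suc x n))

    module _ (r : Params) where

      -- The right-hand side (r_p + a_p S_p)(r_q + a_q S_q) F(a) of the
      -- differential equation satisfied by both sides, S_i being the shift
      -- a_i ↦ a_i + 1 acting on the parameter.
      pairStep : (Params → PS) → Params → Fin k → Fin k → PS
      pairStep F a p q =
        (scale (r p * r q) (F a) ⊕ scale (a p * r q) (F (shift a p))) ⊕
        (scale (r p * a q) (F (shift a q)) ⊕ scale (a p * a q) (F (shift (shift a p) q)))

      record CharlierSystem (F : Params → PS) : Set (c ⊔ ℓ) where
        field
          extensional : ∀ a → ExtM (F a)
          constant    : ∀ a → F a zeroM ≈ 1#
          ∂-above     : ∀ a p q → lt p q ≡ true → D p q (F a) ≋ pairStep F a p q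
          ∂-other     : ∀ a p q → lt p q ≡ false → D p q (F a) ≋ zeroPS

      pairStep-agree : ∀ {F G} a p q e → (∀ a' → F a' e ≈ G a' e) → pairStep F a p q e ≈ pairStep G a p q e
      pairStep-agree a p q e h =
        +-cong (+-cong (*-cong refl (h _)) (*-cong refl (h _))) (+-cong (*-cong refl (h _)) (*-cong refl (h _)))

      -- The Charlier system has at most one solution: the coefficient of x^e,
      -- for all parameters at once, is determined by induction on deg e, as
      -- x^e = x^e' · x_pq and (e'_pq + 1)·[x^e]F = [x^e'] ∂F/∂x_pq.
      uniqueness : ∀ {F G} → CharlierSystem F → CharlierSystem G → ∀ a e → F a e ≈ G a e
      uniqueness {F} {G} sF sG a e = agree (deg e) e P.refl a
        where
        module SF = CharlierSystem sF
        module SG = CharlierSystem sG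

        agree : ∀ N e → deg e ≡ N → ∀ a → F a e ≈ G a e
        agree zero e h a = begin
          F a e     ≈⟨ SF.extensional a (deg-zero e h) ⟩
          F a zeroM ≈⟨ SF.constant a ⟩
          1#        ≈⟨ sym (SG.constant a) ⟩
          G a zeroM ≈⟨ SG.extensional a (λ i j → P.sym (deg-zero e h i j)) ⟩
          G a e     ∎
        agree (suc N) e h a with deg-suc e N h
        ... | p , q , m , e-pq = begin
          F a e                ≈⟨ SF.extensional a (λ i j → P.sym (incr-decr e p q m e-pq i j)) ⟩
          F a (incr e' p q)    ≈⟨ cancel (e' p q) derivatives-agree ⟩
          G a (incr e' p q)    ≈⟨ SG.extensional a (incr-decr e p q m e-pq) ⟩
          G a e                ∎
          where
          e' = decr e p q
          IH : ∀ a' → F a' e' ≈ G a' e'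
          IH = agree N e' (NP.suc-injective (P.trans (P.sym (deg-incr e' p q)) (P.trans (deg-cong (incr-decr e p q m e-pq)) h)))
          derivatives-agree : D p q (F a) e' ≈ D p q (G a) e'
          derivatives-agree with lt p q in l
          ... | true  = trans (SF.∂-above a p q l e') (trans (pairStep-agree {F} {G} a p q e' IH) (sym (SG.∂-above a p q l e')))
          ... | false = trans (SF.∂-other a p q l e') (sym (SG.∂-other a p q l e'))

      charlierProd : (Fin k → ℕ) → Params → Carrier
      charlierProd N a = prodFinR k (λ i → charlier (N i) (a i) (r i))

      charlierProd-cong : ∀ {N N' a a'} → (∀ i → N i ≡ N' i) → (∀ i → a i ≡ a' i) → charlierProd N a ≈ charlierProd N' a'
      charlierProd-cong hN ha = prodFinR-cong k (λ i → reflexive (P.cong₂ (λ n x → charlier n x (r i)) (hN i) (ha i)))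

      -- Raising one degree: the Charlier recurrence in the factor at p.
      charlierProd-step : ∀ N a p → charlierProd (updateAt N p suc) a ≈ r p * charlierProd N a + a p * charlierProd N (shift a p)
      charlierProd-step N a p = prodFinR-linear k _ _ _ p (r p) (a p)
        (λ i ne → reflexive (P.cong (λ n → charlier n (a i) (r i)) (updateAt-minimal i p N ne)))
        (λ i ne → reflexive (P.cong₂ (λ n x → charlier n x (r i)) (updateAt-minimal i p N ne) (P.sym (shift-other a p i ne))))
        (trans (reflexive (P.cong (λ n → charlier n (a p) (r p)) (updateAt-updates p N)))
          (trans (charlier-suc (N p) (a p) (r p))
                 (+-cong refl (*-cong refl (reflexive (P.cong (λ x → charlier (N p) x (r p)) (P.sym (shift-same a p))))))))

      -- Raising the degrees at p ≠ q: the recurrence at p and at q.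
      charlierProd-two : ∀ N a p q → p ≢ q → charlierProd (updateAt (updateAt N p suc) q suc) a ≈
        ((r p * r q) * charlierProd N a + (a p * r q) * charlierProd N (shift a p)) +
        ((r p * a q) * charlierProd N (shift a q) + (a p * a q) * charlierProd N (shift (shift a p) q))
      charlierProd-two N a p q p≢q = begin
        charlierProd (updateAt Np q suc) a
          ≈⟨ charlierProd-step Np a q ⟩
        r q * charlierProd Np a + a q * charlierProd Np (shift a q)
          ≈⟨ +-cong (*-cong refl (charlierProd-step N a p)) (*-cong refl (charlierProd-step N (shift a q) p)) ⟩
        r q * (r p * C a + a p * C (shift a p)) + a q * (r p * C (shift a q) + shift a q p * C (shift (shift a q) p))
          ≈⟨ +-cong refl (*-cong refl (+-cong refl (*-cong (reflexive (shift-other a q p p≢q))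
               (charlierProd-cong {N = N} (λ i → P.refl) (updateAt-commutes p q p≢q a))))) ⟩
        r q * (r p * C a + a p * C (shift a p)) + a q * (r p * C (shift a q) + a p * C (shift (shift a p) q))
          ≈⟨ Sol.solve 8 (λ rp rq ap aq x₀ x₁ x₂ x₃ →
               rq Sol.:* (rp Sol.:* x₀ Sol.:+ ap Sol.:* x₁) Sol.:+ aq Sol.:* (rp Sol.:* x₂ Sol.:+ ap Sol.:* x₃) Sol.:=
               ((rp Sol.:* rq) Sol.:* x₀ Sol.:+ (ap Sol.:* rq) Sol.:* x₁) Sol.:+ ((rp Sol.:* aq) Sol.:* x₂ Sol.:+ (ap Sol.:* aq) Sol.:* x₃))
               refl (r p) (r q) (a p) (a q) (C a) (C (shift a p)) (C (shift a q)) (C (shift (shift a p) q)) ⟩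
        ((r p * r q) * C a + (a p * r q) * C (shift a p)) + ((r p * a q) * C (shift a q) + (a p * a q) * C (shift (shift a p) q)) ∎
        where
        Np = updateAt N p suc
        C = charlierProd N

      lhsCoeff : Params → Mono k → Carrier
      lhsCoeff a d = invMatFact d * charlierProd (rowTotal d) a

      lhsCoeff-cong : ∀ a {d d'} → d ≗ᴹ d' → lhsCoeff a d ≈ lhsCoeff a d'
      lhsCoeff-cong a h = *-cong (invMatFact-cong h) (charlierProd-cong (rowTotal-cong h) (λ i → P.refl))

      lhsCoeff-incr : ∀ a d p q → lt p q ≡ true → fromℕR (suc (d p q)) * lhsCoeff a (incr d p q) ≈
        ((r p * r q) * lhsCoeff a d + (a p * r q) * lhsCoeff (shift a p) d) +
        ((r p * a q) * lhsCoeff (shift a q) d + (a p * a q) * lhsCoeff (shift (shift a p) q) d)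
      lhsCoeff-incr a d p q l = begin
        fromℕR (suc (d p q)) * (invMatFact (incr d p q) * charlierProd (rowTotal (incr d p q)) a)
          ≈⟨ sym (*-assoc _ _ _) ⟩
        (fromℕR (suc (d p q)) * invMatFact (incr d p q)) * charlierProd (rowTotal (incr d p q)) a
          ≈⟨ *-cong (invMatFact-incr d p q l) (charlierProd-cong (rowTotal-incr d p q p≢q) (λ i → P.refl)) ⟩
        invMatFact d * charlierProd (updateAt (updateAt (rowTotal d) p suc) q suc) a
          ≈⟨ *-cong refl (charlierProd-two (rowTotal d) a p q p≢q) ⟩
        invMatFact d * (((r p * r q) * C a + (a p * r q) * C (shift a p)) + ((r p * a q) * C (shift a q) + (a p * a q) * C (shift (shift a p) q)))
          ≈⟨ Sol.solve 9 (λ m x y z t X₀ X₁ X₂ X₃ →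
               m Sol.:* ((x Sol.:* X₀ Sol.:+ y Sol.:* X₁) Sol.:+ (z Sol.:* X₂ Sol.:+ t Sol.:* X₃)) Sol.:=
               (x Sol.:* (m Sol.:* X₀) Sol.:+ y Sol.:* (m Sol.:* X₁)) Sol.:+ (z Sol.:* (m Sol.:* X₂) Sol.:+ t Sol.:* (m Sol.:* X₃)))
               refl (invMatFact d) (r p * r q) (a p * r q) (r p * a q) (a p * a q) (C a) (C (shift a p)) (C (shift a q)) (C (shift (shift a p) q)) ⟩
        ((r p * r q) * lhsCoeff a d + (a p * r q) * lhsCoeff (shift a p) d) +
        ((r p * a q) * lhsCoeff (shift a q) d + (a p * a q) * lhsCoeff (shift (shift a p) q) d) ∎
        where
        p≢q = lt⇒≢ {i = p} {j = q} l
        C = charlierProd (rowTotal d)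

      lhsSeries : Params → PS
      lhsSeries a = sumX (λ d → constPS (lhsCoeff a d))

      lhsTerms-ext : ∀ a → ExtΦ (λ d → constPS (lhsCoeff a d))
      lhsTerms-ext a {d} {d'} {x} {x'} h h' = trans (constPS-ext (lhsCoeff a d) h') (constPS-cong (lhsCoeff-cong a h) x')

      lhs-constant : ∀ a → lhsSeries a zeroM ≈ 1#
      lhs-constant a = trans (sumX-at0 _ (lhsTerms-ext a))
        (trans (constPS-at0 _) (trans (*-cong invMatFact-at0 (prodFinR-one k _ charlier-at0)) (*-identityˡ _)))
        where
        charlier-at0 : ∀ i → charlier (rowTotal zeroM i) (a i) (r i) ≈ 1#
        charlier-at0 i = trans (reflexive (P.cong (λ n → charlier n (a i) (r i)) (rowTotal-zero i)))
          (trans (+-identityʳ _) (trans (*-identityʳ _) (trans (*-identityʳ _) (+-identityʳ _))))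

      -- Differentiating term by term, the coefficient x^d/d! · ∏ C_{n_i} becomes
      -- x^d/d! times the right-hand side of lhsCoeff-incr.
      lhs-∂-above : ∀ a p q → lt p q ≡ true → D p q (lhsSeries a) ≋ pairStep lhsSeries a p q
      lhs-∂-above a p q l =
        ≋-trans (D-sumX-above p q l _ (lhsTerms-ext a))
        (≋-trans (⊕-cong (sumX-cong (λ d → ≋-trans (scale-const _ _) (constPS-cong (lhsCoeff-incr a d p q l))))
                         (≋-trans (sumX-cong (λ d → D-const p q (lhsCoeff a d))) sumX-zero))
        (≋-trans (⊕-identityʳ _)
        (≋-trans (sumX-const-+ (λ d → t₀ d + t₁ d) (λ d → t₂ d + t₃ d))
                 (⊕-cong (≋-trans (sumX-const-+ t₀ t₁) (⊕-cong (sumX-const-* (r p * r q) c₀) (sumX-const-* (a p * r q) c₁)))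
                         (≋-trans (sumX-const-+ t₂ t₃) (⊕-cong (sumX-const-* (r p * a q) c₂) (sumX-const-* (a p * a q) c₃)))))))
        where
        c₀ c₁ c₂ c₃ t₀ t₁ t₂ t₃ : Mono k → Carrier
        c₀ = lhsCoeff a
        c₁ = lhsCoeff (shift a p)
        c₂ = lhsCoeff (shift a q)
        c₃ = lhsCoeff (shift (shift a p) q)
        t₀ d = (r p * r q) * c₀ d
        t₁ d = (a p * r q) * c₁ d
        t₂ d = (r p * a q) * c₂ d
        t₃ d = (a p * a q) * c₃ d

      -- The coefficients are constants, so only the monomials x^d can be
      -- differentiated, and these contain x_pq only for p < q.
      lhs-∂-other : ∀ a p q → lt p q ≡ false → D p q (lhsSeries a) ≋ zeroPS
      lhs-∂-other a p q l = ≋-trans (D-sumX-other p q l _ (lhsTerms-ext a))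
                              (≋-trans (sumX-cong (λ d → D-const p q (lhsCoeff a d))) sumX-zero)

      lhs-solves : CharlierSystem lhsSeries
      lhs-solves = record
        { extensional = λ a → sumX-ext _ (lhsTerms-ext a)
        ; constant    = lhs-constant
        ; ∂-above     = lhs-∂-above
        ; ∂-other     = lhs-∂-other
        }

      rhsProduct : Params → Mono k → PS
      rhsProduct a d = prodFinPS k (λ i → binomFactor (a i) (rowTotal d i) (w r i))

      rhsProduct-ext : ∀ a d → ExtM (rhsProduct a d)
      rhsProduct-ext a d = prodFinPS-ext k _ (λ i → binomFactor-ext (a i) (rowTotal d i) (w r i) (w-ext r i))

      rhsProduct-cong : ∀ a {d d'} → d ≗ᴹ d' → rhsProduct a d ≋ rhsProduct a d'
      rhsProduct-cong a h = prodFinPS-cong k (λ i e → reflexive (P.cong (λ n → binomFactor (a i) n (w r i) e) (rowTotal-cong h i)))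

      -- Raising d_pq raises n_p and n_q, which by binomFactor-suc pulls out a_p a_q
      -- and shifts a_p and a_q.
      rhsProduct-incr : ∀ a d p q → lt p q ≡ true → rhsProduct a (incr d p q) ≋ scale (a p * a q) (rhsProduct (shift (shift a p) q) d)
      rhsProduct-incr a d p q l = ≋-trans (prodFinPS-scale k _ _ γ factor) (scale-cong prod-γ ≋-refl)
        where
        p≢q = lt⇒≢ {i = p} {j = q} l
        a″ = shift (shift a p) q
        γ₁ γ : Fin k → Carrier
        γ₁ = updateAt (λ _ → 1#) p (λ _ → a p)
        γ  = updateAt γ₁ q (λ _ → a q)
        prod-γ : prodFinR k γ ≈ a p * a q
        prod-γ = begin
          prodFinR k γ
            ≈⟨ sym (prodFinR-absorb k γ₁ γ q (a q) (λ i ne → reflexive (P.sym (updateAt-minimal i q γ₁ ne)))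
                   (trans (*-cong refl (reflexive (updateAt-minimal q p _ (p≢q ∘ P.sym))))
                          (trans (*-identityʳ _) (reflexive (P.sym (updateAt-updates q γ₁)))))) ⟩
          a q * prodFinR k γ₁
            ≈⟨ *-cong refl (sym (prodFinR-absorb k (λ _ → 1#) γ₁ p (a p) (λ i ne → reflexive (P.sym (updateAt-minimal i p _ ne)))
                   (trans (*-identityʳ _) (reflexive (P.sym (updateAt-updates p (λ _ → 1#))))))) ⟩
          a q * (a p * prodFinR k (λ _ → 1#))
            ≈⟨ *-cong refl (trans (*-cong refl (prodFinR-one k _ (λ _ → refl))) (*-identityʳ _)) ⟩
          a q * a p
            ≈⟨ *-comm _ _ ⟩
          a p * a q ∎
        factor : ∀ i → binomFactor (a i) (rowTotal (incr d p q) i) (w r i) ≋ scale (γ i) (binomFactor (a″ i) (rowTotal d i) (w r i))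
        factor i with i ≟ p | i ≟ q
        ... | yes P.refl | yes i≡q = ⊥-elim (p≢q i≡q)
        ... | yes P.refl | no iq = λ e → trans
          (reflexive (P.cong (λ n → binomFactor (a i) n (w r i) e) (rowTotal-incr-p d p q p≢q)))
          (trans (binomFactor-suc (a i) (rowTotal d i) (w r i) (w-ext r i) e)
                 (*-cong (reflexive (P.sym (P.trans (updateAt-minimal i q γ₁ iq) (updateAt-updates i (λ _ → 1#)))))
                         (reflexive (P.cong (λ x → binomFactor x (rowTotal d i) (w r i) e)
                            (P.sym (P.trans (shift-other (shift a p) q i iq) (shift-same a p)))))))
        ... | no ip | yes P.refl = λ e → trans
          (reflexive (P.cong (λ n → binomFactor (a i) n (w r i) e) (rowTotal-incr-q d p q p≢q)))
          (trans (binomFactor-suc (a i) (rowTotal d i) (w r i) (w-ext r i) e)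
                 (*-cong (reflexive (P.sym (updateAt-updates i γ₁)))
                         (reflexive (P.cong (λ x → binomFactor x (rowTotal d i) (w r i) e)
                            (P.sym (P.trans (shift-same (shift a p) q) (P.cong (_+ 1#) (shift-other a p q ip))))))))
        ... | no ip | no iq = λ e → trans
          (reflexive (P.cong (λ n → binomFactor (a i) n (w r i) e) (rowTotal-incr-other d p q p≢q i ip iq)))
          (trans (sym (*-identityˡ _))
                 (*-cong (reflexive (P.sym (P.trans (updateAt-minimal i q γ₁ iq) (updateAt-minimal i p _ ip))))
                         (reflexive (P.cong (λ x → binomFactor x (rowTotal d i) (w r i) e)
                            (P.sym (P.trans (shift-other (shift a p) q i iq) (shift-other a p i ip)))))))

      D-rhsProduct : ∀ a d p q → D p q (rhsProduct a d) ≋ sumFinPS k (λ i → scale (a i * ∂w r p q i) (rhsProduct (shift a i) d))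
      D-rhsProduct a d p q = ≋-trans
        (D-prodFinPS p q k _ (λ i → binomFactor (a i + 1#) (rowTotal d i) (w r i)) (λ i → a i * ∂w r p q i)
           (λ i → binomFactor-ext (a i) (rowTotal d i) (w r i) (w-ext r i))
           (λ i → D-binomFactor p q (a i) (rowTotal d i) (w r i) (∂w r p q i) (w-ext r i) (D-w r p q i)))
        (sumFinPS-cong k (λ i → scale-cong refl (prodFinPS-cong k (λ j → shifted i j))))
        where
        shifted : ∀ i j → (if does (j ≟ i) then binomFactor (a j + 1#) (rowTotal d j) (w r j) else binomFactor (a j) (rowTotal d j) (w r j))
                          ≋ binomFactor (shift a i j) (rowTotal d j) (w r j)
        shifted i j with j ≟ i
        ... | yes P.refl = λ e → reflexive (P.cong (λ x → binomFactor x (rowTotal d j) (w r j) e) (P.sym (shift-same a j)))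
        ... | no ne      = λ e → reflexive (P.cong (λ x → binomFactor x (rowTotal d j) (w r j) e) (P.sym (shift-other a i j ne)))

      D-rhsProduct-above : ∀ a d p q → lt p q ≡ true →
        D p q (rhsProduct a d) ≋ (scale (a p * r q) (rhsProduct (shift a p) d) ⊕ scale (r p * a q) (rhsProduct (shift a q) d))
      D-rhsProduct-above a d p q l = ≋-trans (D-rhsProduct a d p q)
        (≋-trans (sumFinPS-two k _ p q (lt⇒≢ {i = p} {j = q} l)
                   (λ i ip iq → ≋-trans (scale-cong (trans (*-cong refl (∂w-off r p q i ip iq)) (zeroʳ _)) ≋-refl) (scale-0# _)))
                 (⊕-cong (scale-cong (*-cong refl (∂w-p r p q l)) ≋-refl)
                         (scale-cong (trans (*-cong refl (∂w-q r p q l)) (*-comm _ _)) ≋-refl)))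

      D-rhsProduct-other : ∀ a d p q → lt p q ≡ false → D p q (rhsProduct a d) ≋ zeroPS
      D-rhsProduct-other a d p q l = ≋-trans (D-rhsProduct a d p q)
        (sumFinPS-zero k _ (λ i → ≋-trans (scale-cong (trans (*-cong refl (∂w-below r p q i l)) (zeroʳ _)) ≋-refl) (scale-0# _)))

      rhsTerm : Params → Mono k → PS
      rhsTerm a d = constPS (invMatFact d) ⊗ rhsProduct a d

      rhsTerm-scale : ∀ a d → rhsTerm a d ≋ scale (invMatFact d) (rhsProduct a d)
      rhsTerm-scale a d = ⊗-constˡ _ (rhsProduct-ext a d) (invMatFact d)

      rhsTerm-ext : ∀ a → ExtΦ (rhsTerm a)
      rhsTerm-ext a {d} {d'} {x} {x'} h h' = trans (⊗-ext (constPS (invMatFact d)) (rhsProduct-ext a d) h')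
        (⊗-cong (constPS-cong (invMatFact-cong h)) (rhsProduct-cong a h) x')

      rhsTerm-incr : ∀ a d p q → lt p q ≡ true →
        scale (fromℕR (suc (d p q))) (rhsTerm a (incr d p q)) ≋ scale (a p * a q) (rhsTerm (shift (shift a p) q) d)
      rhsTerm-incr a d p q l =
        ≋-trans (scale-cong refl (rhsTerm-scale a (incr d p q)))
        (≋-trans (scale-scale _ _ _)
        (≋-trans (scale-cong (invMatFact-incr d p q l) (rhsProduct-incr a d p q l))
        (≋-trans (scale-scale _ _ _)
        (≋-trans (scale-cong (*-comm _ _) ≋-refl)
        (≋-trans (≋-sym (scale-scale _ _ _))
                 (scale-cong refl (≋-sym (rhsTerm-scale (shift (shift a p) q) d))))))))

      D-rhsTerm : ∀ a d p q → D p q (rhsTerm a d) ≋ scale (invMatFact d) (D p q (rhsProduct a d))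
      D-rhsTerm a d p q = ≋-trans (D-cong p q (rhsTerm-scale a d)) (D-scale p q (invMatFact d) (rhsProduct a d))

      rhsSum : Params → PS
      rhsSum a = sumX (rhsTerm a)

      rhsSum-ext : ∀ a → ExtM (rhsSum a)
      rhsSum-ext a = sumX-ext (rhsTerm a) (rhsTerm-ext a)

      D-rhsSum-above : ∀ a p q → lt p q ≡ true → D p q (rhsSum a) ≋
        (scale (a p * a q) (rhsSum (shift (shift a p) q)) ⊕ (scale (a p * r q) (rhsSum (shift a p)) ⊕ scale (r p * a q) (rhsSum (shift a q))))
      D-rhsSum-above a p q l = ≋-trans (D-sumX-above p q l (rhsTerm a) (rhsTerm-ext a))
        (⊕-cong (≋-trans (sumX-cong (λ d → rhsTerm-incr a d p q l)) (sumX-scale (a p * a q) (rhsTerm (shift (shift a p) q))))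
                (≋-trans (sumX-cong termwise)
                (≋-trans (sumX-⊕ (λ d → scale (a p * r q) (rhsTerm (shift a p) d)) (λ d → scale (r p * a q) (rhsTerm (shift a q) d)))
                         (⊕-cong (sumX-scale (a p * r q) (rhsTerm (shift a p))) (sumX-scale (r p * a q) (rhsTerm (shift a q)))))))
        where
        termwise : ∀ d → D p q (rhsTerm a d) ≋ (scale (a p * r q) (rhsTerm (shift a p) d) ⊕ scale (r p * a q) (rhsTerm (shift a q) d))
        termwise d e = trans (D-rhsTerm a d p q e) (trans (*-cong refl (D-rhsProduct-above a d p q l e))
          (trans (distribˡ _ _ _) (+-cong (swap (rhsTerm-scale (shift a p) d e)) (swap (rhsTerm-scale (shift a q) d e)))))
          where
          swap : ∀ {m x y z} → z ≈ m * y → m * (x * y) ≈ x * z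
          swap h = trans (trans (sym (*-assoc _ _ _)) (trans (*-cong (*-comm _ _) refl) (*-assoc _ _ _))) (*-cong refl (sym h))

      D-rhsSum-other : ∀ a p q → lt p q ≡ false → D p q (rhsSum a) ≋ zeroPS
      D-rhsSum-other a p q l = ≋-trans (D-sumX-other p q l (rhsTerm a) (rhsTerm-ext a))
        (≋-trans (sumX-cong (λ d e → trans (D-rhsTerm a d p q e) (trans (*-cong refl (D-rhsProduct-other a d p q l e)) (trans (*-cong refl (zeroPS≈ e)) (trans (zeroʳ _) (sym (zeroPS≈ e)))))))
                 sumX-zero)

      expEntry : Fin k → Fin k → PS
      expEntry i j = if lt i j then expPS (scale (r i * r j) (var i j)) else onePS

      expFactor : PS
      expFactor = prodPairsPS (λ i j → expPS (scale (r i * r j) (var i j)))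

      expEntry-ext : ∀ i j → ExtM (expEntry i j)
      expEntry-ext i j with lt i j
      ... | true  = expPS-ext _ (scale-ext _ (var-ext i j))
      ... | false = onePS-ext

      expFactor-ext : ExtM expFactor
      expFactor-ext = prodFinPS-ext k _ (λ i → prodFinPS-ext k _ (expEntry-ext i))

      -- the logarithmic derivative of each entry
      ε : Fin k → Fin k → Fin k → Fin k → Carrier
      ε p q i j = if lt i j then (r i * r j) * δ p q i j else 0#

      D-expEntry : ∀ p q i j → D p q (expEntry i j) ≋ scale (ε p q i j) (expEntry i j)
      D-expEntry p q i j with lt i j
      ... | true  = D-exp p q _ _ (scale-ext _ (var-ext i j))
                      (≋-trans (D-scale p q (r i * r j) (var i j)) (≋-trans (scale-cong refl (D-var p q i j)) (scale-const (r i * r j) (δ p q i j))))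
      ... | false = ≋-trans (D-const p q 1#) (≋-sym (scale-0# onePS))

      ε-off : ∀ p q i j → ¬ (i ≡ p × j ≡ q) → ε p q i j ≈ 0#
      ε-off p q i j ne with lt i j
      ... | true  = trans (*-cong refl (δ-away p q i j (λ { (P.refl , P.refl) → ne (P.refl , P.refl) }))) (zeroʳ _)
      ... | false = refl

      Σε : ∀ p q → sumFinR k (λ i → sumFinR k (ε p q i)) ≈ ε p q p q
      Σε p q = trans (sumFinR-delta k _ p (λ i ip → sumFinR-zero k _ (λ j → ε-off p q i j (ip ∘ proj₁))))
                     (sumFinR-delta k _ q (λ j jq → ε-off p q p j (jq ∘ proj₂)))

      D-expFactor : ∀ p q → D p q expFactor ≋ scale (ε p q p q) expFactor
      D-expFactor p q =
        ≋-trans (D-prodFinPS-eigen p q k _ (λ i → sumFinR k (ε p q i)) (λ i → prodFinPS-ext k _ (expEntry-ext i))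
                   (λ i → D-prodFinPS-eigen p q k _ (ε p q i) (expEntry-ext i) (D-expEntry p q i)))
                (scale-cong (Σε p q) ≋-refl)

      ε-above : ∀ p q → lt p q ≡ true → ε p q p q ≈ r p * r q
      ε-above p q l rewrite l = trans (*-cong refl (δ-here p q)) (*-identityʳ _)

      ε-other : ∀ p q → lt p q ≡ false → ε p q p q ≈ 0#
      ε-other p q l rewrite l = refl

      rhsSeries : Params → PS
      rhsSeries a = expFactor ⊗ rhsSum a

      rhs-constant : ∀ a → rhsSeries a zeroM ≈ 1#
      rhs-constant a = trans (⊗-at0 _ _ expFactor-ext (rhsSum-ext a)) (trans (*-cong expFactor-at0 rhsSum-at0) (*-identityˡ _))
        where
        expFactor-at0 : expFactor zeroM ≈ 1#
        expFactor-at0 = trans (prodFinPS-at0 k _ (λ i → prodFinPS-ext k _ (expEntry-ext i)))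
          (prodFinR-one k _ (λ i → trans (prodFinPS-at0 k _ (expEntry-ext i)) (prodFinR-one k _ (entry i))))
          where
          entry : ∀ i j → expEntry i j zeroM ≈ 1#
          entry i j with lt i j
          ... | true  = trans (expPS≋egf _ zeroM) (egf-at0 _ _)
          ... | false = constPS-at0 1#
        rhsSum-at0 : rhsSum a zeroM ≈ 1#
        rhsSum-at0 = trans (sumX-at0 _ (rhsTerm-ext a)) (trans (⊗-at0 _ _ (constPS-ext _) (rhsProduct-ext a zeroM))
          (trans (*-cong (trans (constPS-at0 _) invMatFact-at0)
                         (trans (prodFinPS-at0 k _ (λ i → binomFactor-ext (a i) (rowTotal zeroM i) (w r i) (w-ext r i)))
                                (prodFinR-one k _ factor-at0)))
                 (*-identityˡ _)))
          where
          factor-at0 : ∀ i → binomFactor (a i) (rowTotal zeroM i) (w r i) zeroM ≈ 1#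
          factor-at0 i = trans (reflexive (P.cong (λ n → binomFactor (a i) n (w r i) zeroM) (rowTotal-zero i)))
                               (binomFactor-at0 (a i) (w r i) (w-ext r i))

      -- Leibniz: ∂(E·S) = r_p r_q E·S + E·∂S, and ∂S supplies the three shifted terms.
      rhs-∂-above : ∀ a p q → lt p q ≡ true → D p q (rhsSeries a) ≋ pairStep rhsSeries a p q
      rhs-∂-above a p q l = ≋-trans (D-⊗ p q expFactor (rhsSum a) expFactor-ext (rhsSum-ext a))
        (≋-trans (⊕-cong (≋-trans (⊗-congˡ (rhsSum a) (≋-trans (D-expFactor p q) (scale-cong (ε-above p q l) ≋-refl)))
                                  (⊗-scaleˡ (r p * r q) expFactor (rhsSum a)))
                         (≋-trans (⊗-congʳ expFactor (D-rhsSum-above a p q l))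
                         (≋-trans (⊗-distribˡ expFactor (scale (a p * a q) S₂) (scale (a p * r q) Sp ⊕ scale (r p * a q) Sq))
                         (⊕-cong (⊗-scaleʳ (a p * a q) expFactor S₂)
                         (≋-trans (⊗-distribˡ expFactor (scale (a p * r q) Sp) (scale (r p * a q) Sq))
                                  (⊕-cong (⊗-scaleʳ (a p * r q) expFactor Sp) (⊗-scaleʳ (r p * a q) expFactor Sq)))))))
        (λ e → Sol.solve 4 (λ A B C D′ → A Sol.:+ (D′ Sol.:+ (B Sol.:+ C)) Sol.:= (A Sol.:+ B) Sol.:+ (C Sol.:+ D′)) refl _ _ _ _))
        where
        S₂ Sp Sq : PS
        S₂ = rhsSum (shift (shift a p) q)
        Sp = rhsSum (shift a p)
        Sq = rhsSum (shift a q)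

      rhs-∂-other : ∀ a p q → lt p q ≡ false → D p q (rhsSeries a) ≋ zeroPS
      rhs-∂-other a p q l = ≋-trans (D-⊗ p q expFactor (rhsSum a) expFactor-ext (rhsSum-ext a))
        (≋-trans (⊕-cong (≋-trans (⊗-congˡ (rhsSum a) (≋-trans (D-expFactor p q) (≋-trans (scale-cong (ε-other p q l) ≋-refl) (scale-0# _))))
                                  (⊗-zeroˡ (rhsSum a)))
                         (≋-trans (⊗-congʳ expFactor (D-rhsSum-other a p q l)) (⊗-zeroʳ expFactor)))
                 (⊕-identityˡ _))

      rhs-solves : CharlierSystem rhsSeries
      rhs-solves = record
        { extensional = λ a → ⊗-ext expFactor (rhsSum-ext a)
        ; constant    = rhs-constant
        ; ∂-above     = rhs-∂-above
        ; ∂-other     = rhs-∂-other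
        }

-- The theorem: both sides solve the Charlier system, hence agree.
mainTheorem1 : ∀ {c ℓ} (R : CommutativeRing c ℓ) (k : ℕ) → 2 ≤ k →
    (inv : ℕ → CommutativeRing.Carrier R) →
    (∀ n → CommutativeRing._≈_ R (CommutativeRing._*_ R (Series.fromℕR R k (suc n)) (inv (suc n))) (CommutativeRing.1# R)) →
    (a r : Fin k → CommutativeRing.Carrier R) →
    (e : Mono k) →
    CommutativeRing._≈_ R (Series.WithInverses.lhs R k inv a r e) (Series.WithInverses.rhs R k inv a r e)
mainTheorem1 R k _ inv invH a r e =
  uniqueness inv invH r (lhs-solves inv invH r) (rhs-solves inv invH r) a e
  where open Development R k
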